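{- For $\alpha,\beta\in\mathbb{Z}/N\mathbb{Z}$, $s_1,s_2\in\mathbb{N}$ with $s_1+s_2>2$ and $s=s_1+s_2-2$ we have \begin{align*} \binom{s}{s_1-1} \frac{\mathfrak{D}[s;\alpha+\beta]}{s} &\, = [s_1;\alpha]\cdot [s_2;\beta] +\binom{s}{s_1-1} [s+1;\alpha+\beta] \\ &\, - \sum_{a+b=s+2} \left( \binom{a-1}{s_1-1}[a,b;\alpha+\beta,\beta] +\binom{a-1}{s_2-1}[a,b;\alpha+\beta,\alpha] \right), \end{align*} where $\mathfrak{D}=q\frac{d}{dq}$.
   Context: Fix $N\ge1$, $\eta=\exp(2\pi\sqrt{ -1}/N)$ and $\mathbb{Q}_N=\mathbb{Q}(\eta)$. For $\mathbf{s}=(s_1,\dots,s_d)\in\mathbb{N}^d$ and $\boldsymbol{\alpha}=(\alpha_1,\dots,\alpha_d)\in(\mathbb{Z}/N\mathbb{Z})^d$ the multiple divisor function at level $N$ is the $q$-series $[\mathbf{s};\boldsymbol{\alpha}] = \frac{1}{(s_1-1)!\cdots(s_d-1)!}\sum_{n>0}\Big(\sum_{u_1v_1+\cdots+u_dv_d=n,\ u_1>\dots>u_d>0}\eta^{\alpha_1v_1+\cdots+\alpha_dv_d}v_1^{s_1-1}\cdots v_d^{s_d-1}\Big)q^n\in\mathbb{Q}_N[\![q]\!]$; products are products of power series. The sum $\sum_{a+b=s+2}$ runs over $a,b\in\mathbb{N}$. -}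

module Defs where

open import Level using (Level)
open import Algebra.Bundles using (CommutativeRing)
open import Data.Nat as ℕ using (ℕ; zero; suc; _∸_; _≡ᵇ_; _<ᵇ_; NonZero)
open import Data.Nat.Combinatorics using (_C_)
open import Data.Nat.Base using (_!)
open import Data.Nat.DivMod using (_mod_)
open import Data.Fin using (Fin; toℕ)
open import Data.Bool using (Bool; true; false; if_then_else_; _∧_)
open import Data.List using (List; []; _∷_; map; upTo; foldr)
open import Data.Integer using (+_)
open import Data.Rational using (ℚ; 0ℚ; _/_)
import Data.Rational

natℚ : ℕ → ℚ
natℚ n = + n / 1

-- 1/n for n > 0 (convention: value 0 at n = 0, only ever used for n > 0)
invℚ : ℕ → ℚ
invℚ zero = 0ℚ
invℚ (suc k) = + 1 / suc k

range1 : ℕ → List ℕ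
range1 n = map suc (upTo n)

-- addition in ℤ/Nℤ, represented as Fin N
addMod : (N : ℕ) .{{_ : NonZero N}} → Fin N → Fin N → Fin N
addMod N α β = (toℕ α ℕ.+ toℕ β) mod N

-- q-series over a commutative ring R equipped with a map ι : ℚ → R
-- (assumed, in the statement, to be a ring homomorphism) and an element η
-- (assumed, in the statement, to be a primitive N-th root of unity).
module Series {c ℓ : Level} (R : CommutativeRing c ℓ) (ι : ℚ → CommutativeRing.Carrier R)
              (η : CommutativeRing.Carrier R) where
  open CommutativeRing R

  QSeries : Set c
  QSeries = ℕ → Carrier

  pow : Carrier → ℕ → Carrier
  pow x zero = 1#
  pow x (suc n) = x * pow x n

  sumL : List Carrier → Carrier
  sumL = foldr _+_ 0#

  Σ1 : ℕ → (ℕ → Carrier) → Carrier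
  Σ1 n f = sumL (map f (range1 n))

  -- depth one: [s;α] = 1/(s-1)! Σ_{n>0} (Σ_{uv=n, u>0} η^{αv} v^{s-1}) q^n
  -- (u, v range over positive integers; they are ≤ n automatically)
  div1 : {N : ℕ} → ℕ → Fin N → QSeries
  div1 s α n =
    ι (invℚ ((s ∸ 1) !)) *
    Σ1 n (λ u → Σ1 n (λ v →
      if (u ℕ.* v) ≡ᵇ n
      then pow η (toℕ α ℕ.* v) * ι (natℚ (v ℕ.^ (s ∸ 1)))
      else 0#))

  -- depth two: [s1,s2;α1,α2] = 1/((s1-1)!(s2-1)!) Σ_{n>0}
  --   (Σ_{u1v1+u2v2=n, u1>u2>0} η^{α1v1+α2v2} v1^{s1-1} v2^{s2-1}) q^n
  div2 : {N : ℕ} → ℕ → ℕ → Fin N → Fin N → QSeries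
  div2 s₁ s₂ α₁ α₂ n =
    ι (invℚ ((s₁ ∸ 1) !) Data.Rational.* invℚ ((s₂ ∸ 1) !)) *
    Σ1 n (λ u₁ → Σ1 n (λ u₂ → Σ1 n (λ v₁ → Σ1 n (λ v₂ →
      if ((u₁ ℕ.* v₁ ℕ.+ u₂ ℕ.* v₂) ≡ᵇ n) ∧ (u₂ <ᵇ u₁)
      then pow η (toℕ α₁ ℕ.* v₁ ℕ.+ toℕ α₂ ℕ.* v₂)
             * ι (natℚ (v₁ ℕ.^ (s₁ ∸ 1) ℕ.* v₂ ℕ.^ (s₂ ∸ 1)))
      else 0#))))

  _⋆_ : QSeries → QSeries → QSeries
  (f ⋆ g) n = sumL (map (λ k → f k * g (n ∸ k)) (upTo (suc n)))

  𝔇 : QSeries → QSeries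
  𝔇 f n = ι (natℚ n) * f n

module Submission where

-- The coefficient of qⁿ in [s₁;α]·[s₂;β] is (p! q!)⁻¹ Σ η^(αv₁+βv₂) v₁^p v₂^q over
-- u₁v₁ + u₂v₂ = n (p = s₁-1, q = s₂-1), and we split it according to v₁ < v₂, v₁ = v₂, v₁ > v₂.
-- For v₁ < v₂ put v₂ = v₁ + w and U = u₁ + u₂: the condition becomes Uv₁ + u₂w = n with U > u₂,
-- and expanding v₁^p (v₁ + w)^q binomially gives Σₐ C(a-1,p) [a, s+2-a; α+β, β]; the part
-- v₁ > v₂ is the same with the roles of (α, s₁) and (β, s₂) exchanged. For v₁ = v₂ = v each U
-- is hit by U - 1 pairs (u₁, u₂); adding C(s,p) [s+1; α+β] turns U - 1 into U, and Uv = n turns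
-- the sum into n times the coefficient of [s; α+β], i.e. into the derivative 𝔇.

open import Defs
open import Level using (Level)
open import Algebra.Bundles using (CommutativeRing; CommutativeSemiring; CommutativeMonoid; AbelianGroup)
open import Algebra.Morphism.Structures using (IsRingHomomorphism)
open import Data.Nat as ℕ using (ℕ; zero; suc; _∸_; _≤_; _<_; z≤n; s≤s; z<s; _≡ᵇ_; _<ᵇ_; NonZero)
import Data.Nat.Properties as ℕ
open import Data.Nat.Base using (_!)
open import Data.Nat.Combinatorics using (_C_; nCk≡n!/k![n-k]!; k>n⇒nCk≡0; k![n∸k]!∣n!)
open import Data.Nat.DivMod using (_%_; _/_; m/n*n≡m; m%n<n; m≡m%n+[m/n]*n)
open import Data.Bool using (Bool; true; false; T; if_then_else_; _∧_)
open import Data.Sum using (inj₁; inj₂)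
open import Data.List using (foldr; map; applyUpTo)
open import Data.List.Properties using (map-applyUpTo)
open import Data.Fin using (Fin; toℕ)
open import Data.Fin.Properties using (toℕ-fromℕ<)
import Data.Integer as ℤ
import Data.Integer.Properties as ℤ
open import Data.Rational using (ℚ)
import Data.Rational
import Data.Rational as ℚ
import Data.Rational.Properties as ℚ
open import Data.Rational.Properties using (+-*-rawRing)
open import Data.Rational.Unnormalised as ℚᵘ using (mkℚᵘ; *≡*)
import Data.Rational.Unnormalised.Properties as ℚᵘ
open import Function using (id; _∘_)
open import Relation.Binary.Definitions using (tri<; tri≈; tri>)
open import Relation.Binary.PropositionalEquality as ≡ using (_≡_; _≢_)
open import Relation.Nullary using (¬_; contradiction; yes; no)
import Data.Integer.Solver
import Data.Nat.Solver
import Algebra.Properties.CommutativeSemiring.Binomial as Binomial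
import Algebra.Properties.CommutativeSemiring.Exp as CommutativeSemiringExp
import Algebra.Properties.CommutativeSemigroup as CommutativeSemigroupProperties
import Algebra.Properties.Semiring.Exp as SemiringExp
import Algebra.Properties.Semiring.Mult as SemiringMult
import Algebra.Properties.Semiring.Sum as SemiringSum

private
  toℚᵘ-natℚ : ∀ m → ℚ.toℚᵘ (natℚ m) ℚᵘ.≃ mkℚᵘ (ℤ.+ m) 0
  toℚᵘ-natℚ m = ℚ.toℚᵘ-fromℚᵘ (mkℚᵘ (ℤ.+ m) 0)

natℚ-+ : ∀ m n → natℚ (m ℕ.+ n) ≡ natℚ m ℚ.+ natℚ n
natℚ-+ m n = ℚ.toℚᵘ-injective (begin
  ℚ.toℚᵘ (natℚ (m ℕ.+ n))                 ≈⟨ toℚᵘ-natℚ (m ℕ.+ n) ⟩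
  mkℚᵘ (ℤ.+ (m ℕ.+ n)) 0                   ≈⟨ *≡* (≡.trans (≡.cong (ℤ._* ℤ.+ 1) (ℤ.pos-+ m n))
                                                (solve 2 (λ x y → (x :+ y) :* con (ℤ.+ 1)
                                                                := (x :* con (ℤ.+ 1) :+ y :* con (ℤ.+ 1)) :* con (ℤ.+ 1))
                                                       ≡.refl (ℤ.+ m) (ℤ.+ n))) ⟩
  mkℚᵘ (ℤ.+ m) 0 ℚᵘ.+ mkℚᵘ (ℤ.+ n) 0       ≈⟨ ℚᵘ.+-cong (toℚᵘ-natℚ m) (toℚᵘ-natℚ n) ⟨
  ℚ.toℚᵘ (natℚ m) ℚᵘ.+ ℚ.toℚᵘ (natℚ n)    ≈⟨ ℚ.toℚᵘ-homo-+ (natℚ m) (natℚ n) ⟨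
  ℚ.toℚᵘ (natℚ m ℚ.+ natℚ n)              ∎)
  where open ℚᵘ.≃-Reasoning; open Data.Integer.Solver.+-*-Solver

natℚ-* : ∀ m n → natℚ (m ℕ.* n) ≡ natℚ m ℚ.* natℚ n
natℚ-* m n = ℚ.toℚᵘ-injective (begin
  ℚ.toℚᵘ (natℚ (m ℕ.* n))                 ≈⟨ toℚᵘ-natℚ (m ℕ.* n) ⟩
  mkℚᵘ (ℤ.+ (m ℕ.* n)) 0                   ≈⟨ *≡* (≡.cong (ℤ._* ℤ.+ 1) (ℤ.pos-* m n)) ⟩
  mkℚᵘ (ℤ.+ m) 0 ℚᵘ.* mkℚᵘ (ℤ.+ n) 0       ≈⟨ ℚᵘ.*-cong (toℚᵘ-natℚ m) (toℚᵘ-natℚ n) ⟨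
  ℚ.toℚᵘ (natℚ m) ℚᵘ.* ℚ.toℚᵘ (natℚ n)    ≈⟨ ℚ.toℚᵘ-homo-* (natℚ m) (natℚ n) ⟨
  ℚ.toℚᵘ (natℚ m ℚ.* natℚ n)              ∎)
  where open ℚᵘ.≃-Reasoning

invℚ-*-natℚ : ∀ n → invℚ (suc n) ℚ.* natℚ (suc n) ≡ ℚ.1ℚ
invℚ-*-natℚ n = ℚ.toℚᵘ-injective (begin
  ℚ.toℚᵘ (invℚ (suc n) ℚ.* natℚ (suc n))             ≈⟨ ℚ.toℚᵘ-homo-* (invℚ (suc n)) (natℚ (suc n)) ⟩
  ℚ.toℚᵘ (invℚ (suc n)) ℚᵘ.* ℚ.toℚᵘ (natℚ (suc n))   ≈⟨ ℚᵘ.*-cong (ℚ.toℚᵘ-fromℚᵘ (mkℚᵘ (ℤ.+ 1) n)) (toℚᵘ-natℚ (suc n)) ⟩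
  mkℚᵘ (ℤ.+ 1) n ℚᵘ.* mkℚᵘ (ℤ.+ suc n) 0             ≈⟨ *≡* (≡.cong (λ k → ℤ.+ suc k)
                                                          (solve 1 (λ k → (k :+ con 0 :* (con 1 :+ k)) :* con 1
                                                                        := k :* con 1 :+ con 0 :* (con 1 :+ k :* con 1))
                                                                 ≡.refl n)) ⟩
  ℚ.toℚᵘ ℚ.1ℚ                                        ∎)
  where open ℚᵘ.≃-Reasoning; open Data.Nat.Solver.+-*-Solver

module Sums {ℓ₁ ℓ₂} (S : CommutativeSemiring ℓ₁ ℓ₂) where
  open CommutativeSemiring S
  open import Relation.Binary.Reasoning.Setoid setoid
  open SemiringSum semiring using (sum)
  open SemiringMult semiring using (_×_)
  open CommutativeSemigroupProperties (CommutativeMonoid.commutativeSemigroup +-commutativeMonoid)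
    using () renaming (interchange to +-interchange)

  -- ∑ m n f = f m + f (m + 1) + ⋯ + f (m + n ∸ 1): n terms starting at index m.
  ∑ : ℕ → ℕ → (ℕ → Carrier) → Carrier
  ∑ m zero    f = 0#
  ∑ m (suc n) f = f m + ∑ (suc m) n f

  ∑-suc : ∀ m n (f : ℕ → Carrier) → ∑ (suc m) n f ≡ ∑ m n (λ i → f (suc i))
  ∑-suc m zero    f = ≡.refl
  ∑-suc m (suc n) f = ≡.cong (f (suc m) +_) (∑-suc (suc m) n f)

  ∑-translate : ∀ k m n (f : ℕ → Carrier) → ∑ (k ℕ.+ m) n f ≡ ∑ m n (λ i → f (k ℕ.+ i))
  ∑-translate k m zero    f = ≡.refl
  ∑-translate k m (suc n) f = ≡.cong (f (k ℕ.+ m) +_)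
    (≡.trans (≡.cong (λ l → ∑ l n f) (≡.sym (ℕ.+-suc k m))) (∑-translate k (suc m) n f))

  sum≡∑ : ∀ n (f : ℕ → Carrier) → sum {n} (λ i → f (toℕ i)) ≡ ∑ 0 n f
  sum≡∑ zero    f = ≡.refl
  sum≡∑ (suc n) f = ≡.cong (f 0 +_) (≡.trans (sum≡∑ n (λ i → f (suc i))) (≡.sym (∑-suc 0 n f)))

  foldr-applyUpTo : ∀ n (f : ℕ → Carrier) → foldr _+_ 0# (applyUpTo f n) ≡ ∑ 0 n f
  foldr-applyUpTo zero    f = ≡.refl
  foldr-applyUpTo (suc n) f = ≡.cong (f 0 +_) (≡.trans (foldr-applyUpTo n (λ i → f (suc i))) (≡.sym (∑-suc 0 n f)))

  ∑-cong-< : ∀ m n {f g : ℕ → Carrier} → (∀ i → m ≤ i → i < n ℕ.+ m → f i ≈ g i) → ∑ m n f ≈ ∑ m n g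
  ∑-cong-< m zero    f≈g = refl
  ∑-cong-< m (suc n) f≈g = +-cong (f≈g m ℕ.≤-refl (s≤s (ℕ.m≤n+m m n)))
    (∑-cong-< (suc m) n (λ i m<i i<n+1+m → f≈g i (ℕ.<⇒≤ m<i) (≡.subst (i <_) (ℕ.+-suc n m) i<n+1+m)))

  ∑-cong : ∀ m n {f g : ℕ → Carrier} → (∀ i → f i ≈ g i) → ∑ m n f ≈ ∑ m n g
  ∑-cong m n f≈g = ∑-cong-< m n (λ i _ _ → f≈g i)

  ∑-0# : ∀ m n → ∑ m n (λ _ → 0#) ≈ 0#
  ∑-0# m zero    = refl
  ∑-0# m (suc n) = trans (+-identityˡ _) (∑-0# (suc m) n)

  ∑-zero : ∀ m n {f : ℕ → Carrier} → (∀ i → m ≤ i → i < n ℕ.+ m → f i ≈ 0#) → ∑ m n f ≈ 0#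
  ∑-zero m n f≈0 = trans (∑-cong-< m n f≈0) (∑-0# m n)

  ∑-distrib-+ : ∀ m n (f g : ℕ → Carrier) → ∑ m n (λ i → f i + g i) ≈ ∑ m n f + ∑ m n g
  ∑-distrib-+ m zero    f g = sym (+-identityˡ 0#)
  ∑-distrib-+ m (suc n) f g = trans (+-congˡ (∑-distrib-+ (suc m) n f g)) (+-interchange _ _ _ _)

  *-distribˡ-∑ : ∀ m n x (f : ℕ → Carrier) → x * ∑ m n f ≈ ∑ m n (λ i → x * f i)
  *-distribˡ-∑ m zero    x f = zeroʳ x
  *-distribˡ-∑ m (suc n) x f = trans (distribˡ x _ _) (+-congˡ (*-distribˡ-∑ (suc m) n x f))

  *-distribʳ-∑ : ∀ m n x (f : ℕ → Carrier) → ∑ m n f * x ≈ ∑ m n (λ i → f i * x)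
  *-distribʳ-∑ m zero    x f = zeroˡ x
  *-distribʳ-∑ m (suc n) x f = trans (distribʳ x _ _) (+-congˡ (*-distribʳ-∑ (suc m) n x f))

  ∑-comm : ∀ m n m′ n′ (f : ℕ → ℕ → Carrier) →
           ∑ m n (λ i → ∑ m′ n′ (f i)) ≈ ∑ m′ n′ (λ j → ∑ m n (λ i → f i j))
  ∑-comm m zero    m′ n′ f = sym (∑-0# m′ n′)
  ∑-comm m (suc n) m′ n′ f = trans (+-congˡ (∑-comm (suc m) n m′ n′ f)) (sym (∑-distrib-+ m′ n′ _ _))

  ∑-*-∑ : ∀ m n m′ n′ (f g : ℕ → Carrier) → ∑ m n f * ∑ m′ n′ g ≈ ∑ m n (λ i → ∑ m′ n′ (λ j → f i * g j))
  ∑-*-∑ m n m′ n′ f g = trans (*-distribʳ-∑ m n _ f) (∑-cong m n (λ i → *-distribˡ-∑ m′ n′ (f i) g))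

  ∑-split : ∀ m k l (f : ℕ → Carrier) → ∑ m (k ℕ.+ l) f ≈ ∑ m k f + ∑ (k ℕ.+ m) l f
  ∑-split m zero    l f = sym (+-identityˡ _)
  ∑-split m (suc k) l f = trans (+-congˡ (trans (∑-split (suc m) k l f)
                                  (+-congˡ (reflexive (≡.cong (λ j → ∑ j l f) (ℕ.+-suc k m))))))
                                (sym (+-assoc _ _ _))

  ∑-extend : ∀ m {n n′} (f : ℕ → Carrier) → n ≤ n′ → (∀ i → n ℕ.+ m ≤ i → f i ≈ 0#) → ∑ m n f ≈ ∑ m n′ f
  ∑-extend m {n} {n′} f n≤n′ f≈0 = begin
    ∑ m n f                                ≈⟨ +-identityʳ _ ⟨
    ∑ m n f + 0#                           ≈⟨ +-congˡ (∑-zero (n ℕ.+ m) (n′ ∸ n) (λ i n+m≤i _ → f≈0 i n+m≤i)) ⟨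
    ∑ m n f + ∑ (n ℕ.+ m) (n′ ∸ n) f       ≈⟨ ∑-split m n (n′ ∸ n) f ⟨
    ∑ m (n ℕ.+ (n′ ∸ n)) f                 ≡⟨ ≡.cong (λ l → ∑ m l f) (ℕ.m+[n∸m]≡n n≤n′) ⟩
    ∑ m n′ f                               ∎

  ∑-drop : ∀ m k n (f : ℕ → Carrier) → (∀ i → m ≤ i → i < k ℕ.+ m → f i ≈ 0#) → ∑ m n f ≈ ∑ (k ℕ.+ m) (n ∸ k) f
  ∑-drop m k n f f≈0 with ℕ.≤-total k n
  ... | inj₁ k≤n = begin
    ∑ m n f                               ≡⟨ ≡.cong (λ l → ∑ m l f) (ℕ.m+[n∸m]≡n k≤n) ⟨
    ∑ m (k ℕ.+ (n ∸ k)) f                 ≈⟨ ∑-split m k (n ∸ k) f ⟩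
    ∑ m k f + ∑ (k ℕ.+ m) (n ∸ k) f       ≈⟨ +-congʳ (∑-zero m k f≈0) ⟩
    0# + ∑ (k ℕ.+ m) (n ∸ k) f            ≈⟨ +-identityˡ _ ⟩
    ∑ (k ℕ.+ m) (n ∸ k) f                 ∎
  ... | inj₂ n≤k = trans (∑-zero m n (λ i m≤i i<n+m → f≈0 i m≤i (ℕ.<-≤-trans i<n+m (ℕ.+-monoˡ-≤ m n≤k))))
                         (reflexive (≡.cong (λ l → ∑ (k ℕ.+ m) l f) (≡.sym (ℕ.m≤n⇒m∸n≡0 n≤k))))

  𝟙 : Bool → Carrier
  𝟙 true  = 1#
  𝟙 false = 0#

  if≈𝟙* : ∀ b x → (if b then x else 0#) ≈ 𝟙 b * x
  if≈𝟙* true  x = sym (*-identityˡ x)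
  if≈𝟙* false x = sym (zeroˡ x)

  𝟙-∧ : ∀ a b → 𝟙 (a ∧ b) ≈ 𝟙 a * 𝟙 b
  𝟙-∧ true  b = sym (*-identityˡ _)
  𝟙-∧ false b = sym (zeroˡ _)

  𝟙-true : ∀ {b} → T b → 𝟙 b ≈ 1#
  𝟙-true {true} _ = refl

  𝟙-false : ∀ {b} → ¬ T b → 𝟙 b ≈ 0#
  𝟙-false {true}  ¬b = contradiction _ ¬b
  𝟙-false {false} _  = refl

  𝟙-true* : ∀ {b} → T b → ∀ x → 𝟙 b * x ≈ x
  𝟙-true* b x = trans (*-congʳ (𝟙-true b)) (*-identityˡ x)

  𝟙-false* : ∀ {b} → ¬ T b → ∀ x → 𝟙 b * x ≈ 0#
  𝟙-false* ¬b x = trans (*-congʳ (𝟙-false ¬b)) (zeroˡ x)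

  𝟙-cong : ∀ {a b} → (T a → T b) → (T b → T a) → 𝟙 a ≈ 𝟙 b
  𝟙-cong {true}  {true}  _   _   = refl
  𝟙-cong {true}  {false} a⇒b _   = contradiction _ a⇒b
  𝟙-cong {false} {true}  _   b⇒a = contradiction _ b⇒a
  𝟙-cong {false} {false} _   _   = refl

  𝟙-≡ᵇ-≢ : ∀ {m n} → m ≢ n → ∀ x → 𝟙 (m ≡ᵇ n) * x ≈ 0#
  𝟙-≡ᵇ-≢ {m} {n} m≢n = 𝟙-false* (m≢n ∘ ℕ.≡ᵇ⇒≡ m n)

  𝟙-≡ᵇ-subst : ∀ (f : ℕ → Carrier) m n → 𝟙 (m ≡ᵇ n) * f m ≈ 𝟙 (m ≡ᵇ n) * f n
  𝟙-≡ᵇ-subst f m n with m ≡ᵇ n in eq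
  ... | true  = *-congˡ (reflexive (≡.cong f (ℕ.≡ᵇ⇒≡ m n (≡.subst T (≡.sym eq) _))))
  ... | false = trans (zeroˡ _) (sym (zeroˡ _))

  𝟙-trichotomy : ∀ x y → 𝟙 (x <ᵇ y) + (𝟙 (x ≡ᵇ y) + 𝟙 (y <ᵇ x)) ≈ 1#
  𝟙-trichotomy x y with ℕ.<-cmp x y
  ... | tri< x<y x≢y y≮x =
    trans (+-cong (𝟙-true (ℕ.<⇒<ᵇ x<y)) (+-cong (𝟙-false (x≢y ∘ ℕ.≡ᵇ⇒≡ x y)) (𝟙-false (y≮x ∘ ℕ.<ᵇ⇒< y x))))
          (trans (+-congˡ (+-identityˡ 0#)) (+-identityʳ 1#))
  ... | tri≈ x≮y x≡y y≮x =
    trans (+-cong (𝟙-false (x≮y ∘ ℕ.<ᵇ⇒< x y)) (+-cong (𝟙-true (ℕ.≡⇒≡ᵇ x y x≡y)) (𝟙-false (y≮x ∘ ℕ.<ᵇ⇒< y x))))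
          (trans (+-identityˡ _) (+-identityʳ 1#))
  ... | tri> x≮y x≢y y<x =
    trans (+-cong (𝟙-false (x≮y ∘ ℕ.<ᵇ⇒< x y)) (+-cong (𝟙-false (x≢y ∘ ℕ.≡ᵇ⇒≡ x y)) (𝟙-true (ℕ.<⇒<ᵇ y<x))))
          (trans (+-identityˡ _) (+-identityˡ 1#))

  ∑-delta : ∀ m n {j} (g : ℕ → Carrier) → m ≤ j → j < n ℕ.+ m → ∑ m n (λ i → 𝟙 (j ≡ᵇ i) * g i) ≈ g j
  ∑-delta m zero    g m≤j j<m = contradiction m≤j (ℕ.<⇒≱ j<m)
  ∑-delta m (suc n) {j} g m≤j j<1+n+m with m ℕ.≟ j
  ... | yes ≡.refl = trans (+-cong (𝟙-true* (ℕ.≡⇒≡ᵇ m m ≡.refl) (g m))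
                                   (∑-zero (suc m) n (λ i m<i _ → 𝟙-≡ᵇ-≢ (ℕ.<⇒≢ m<i) (g i))))
                           (+-identityʳ _)
  ... | no m≢j = trans (+-cong (𝟙-false* (m≢j ∘ ≡.sym ∘ ℕ.≡ᵇ⇒≡ j m) (g m))
                               (∑-delta (suc m) n g (ℕ.≤∧≢⇒< m≤j m≢j) (≡.subst (j <_) (≡.sym (ℕ.+-suc n m)) j<1+n+m)))
                       (+-identityˡ _)

  ∑-delta-out : ∀ m n {j} (g : ℕ → Carrier) → n ℕ.+ m ≤ j → ∑ m n (λ i → 𝟙 (j ≡ᵇ i) * g i) ≈ 0#
  ∑-delta-out m n g n+m≤j = ∑-zero m n (λ i _ i<n+m → 𝟙-≡ᵇ-≢ (ℕ.>⇒≢ (ℕ.<-≤-trans i<n+m n+m≤j)) (g i))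

  ∑-𝟙-<ᵇ : ∀ m n {U} x → U ≤ n → ∑ m n (λ i → 𝟙 (i <ᵇ m ℕ.+ U) * x) ≈ U × x
  ∑-𝟙-<ᵇ m n {zero} x _ =
    ∑-zero m n (λ i m≤i _ → 𝟙-false* (λ i<m+0 → ℕ.<⇒≱ (ℕ.<ᵇ⇒< i _ i<m+0) (ℕ.≤-trans (ℕ.≤-reflexive (ℕ.+-identityʳ m)) m≤i)) x)
  ∑-𝟙-<ᵇ m (suc n) {suc U} x (s≤s U≤n) =
    +-cong (𝟙-true* (ℕ.<⇒<ᵇ (ℕ.m<m+n m z<s)) x)
           (trans (∑-cong (suc m) n (λ i → reflexive (≡.cong (λ b → 𝟙 (i <ᵇ b) * x) (ℕ.+-suc m U))))
                  (∑-𝟙-<ᵇ (suc m) n x U≤n))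

  ∑-shift : ∀ n k (h : ℕ → Carrier) → (∀ x → n < x → h x ≈ 0#) →
            ∑ 1 n (λ x → 𝟙 (k <ᵇ x) * h x) ≈ ∑ 1 n (λ w → h (k ℕ.+ w))
  ∑-shift n k h h≈0 = begin
    ∑ 1 n (λ x → 𝟙 (k <ᵇ x) * h x)
      ≈⟨ ∑-drop 1 k n _ (λ i _ i<k+1 → 𝟙-false* (λ k<i → ℕ.<⇒≱ (ℕ.<ᵇ⇒< k i k<i)
                                                   (ℕ.s≤s⁻¹ (≡.subst (i <_) (ℕ.+-comm k 1) i<k+1))) (h i)) ⟩
    ∑ (k ℕ.+ 1) (n ∸ k) (λ x → 𝟙 (k <ᵇ x) * h x)
      ≈⟨ ∑-cong-< (k ℕ.+ 1) (n ∸ k) (λ i k+1≤i _ → 𝟙-true* (ℕ.<⇒<ᵇ (≡.subst (_≤ i) (ℕ.+-comm k 1) k+1≤i)) (h i)) ⟩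
    ∑ (k ℕ.+ 1) (n ∸ k) h
      ≡⟨ ∑-translate k 1 (n ∸ k) h ⟩
    ∑ 1 (n ∸ k) (λ w → h (k ℕ.+ w))
      ≈⟨ ∑-extend 1 _ (ℕ.m∸n≤m n k) (λ w n∸k+1≤w → h≈0 _ (ℕ.<-≤-trans
            (ℕ.≤-<-trans (ℕ.m≤n+m∸n n k) (ℕ.+-monoʳ-< k (ℕ.m<m+n (n ∸ k) z<s))) (ℕ.+-monoʳ-≤ k n∸k+1≤w))) ⟩
    ∑ 1 n (λ w → h (k ℕ.+ w))
      ∎

module ℕ-Sums = Sums ℕ.+-*-commutativeSemiring

binomial-theoremℕ : ∀ q x y → (x ℕ.+ y) ℕ.^ q ≡ ℕ-Sums.∑ 0 (suc q) (λ i → (q C i) ℕ.* (x ℕ.^ i ℕ.* y ℕ.^ (q ∸ i)))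
binomial-theoremℕ q x y = begin
  (x ℕ.+ y) ℕ.^ q
    ≡⟨ ^≡^ (x ℕ.+ y) q ⟨
  (x ℕ.+ y) ^ q
    ≡⟨ Binomial.theorem ℕ.+-*-commutativeSemiring q x y ⟩
  Binomial.binomialExpansion ℕ.+-*-commutativeSemiring x y q
    ≡⟨ ℕ-Sums.sum≡∑ (suc q) (λ i → (q C i) × (x ^ i ℕ.* y ^ (q ∸ i))) ⟩
  ℕ-Sums.∑ 0 (suc q) (λ i → (q C i) × (x ^ i ℕ.* y ^ (q ∸ i)))
    ≡⟨ ℕ-Sums.∑-cong 0 (suc q) (λ i → ≡.trans (×≡* (q C i) _)
                                  (≡.cong₂ (λ a b → (q C i) ℕ.* (a ℕ.* b)) (^≡^ x i) (^≡^ y (q ∸ i)))) ⟩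
  ℕ-Sums.∑ 0 (suc q) (λ i → (q C i) ℕ.* (x ℕ.^ i ℕ.* y ℕ.^ (q ∸ i)))
    ∎
  where
  open ≡.≡-Reasoning
  open SemiringExp ℕ.+-*-semiring using (_^_)
  open SemiringMult ℕ.+-*-semiring using (_×_)
  ^≡^ : ∀ x n → x ^ n ≡ x ℕ.^ n
  ^≡^ x zero    = ≡.refl
  ^≡^ x (suc n) = ≡.cong (x ℕ.*_) (^≡^ x n)
  ×≡* : ∀ n x → n × x ≡ n ℕ.* x
  ×≡* zero    x = ≡.refl
  ×≡* (suc n) x = ≡.cong (x ℕ.+_) (×≡* n x)

module DivisorSums {ℓ₁ ℓ₂} (S : CommutativeSemiring ℓ₁ ℓ₂) where
  open CommutativeSemiring S
  open Sums S
  open SemiringMult semiring using (_×_; ×-comm-*)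
  open CommutativeSemigroupProperties (CommutativeMonoid.commutativeSemigroup *-commutativeMonoid)
    using (x∙yz≈y∙xz; interchange)
  open import Relation.Binary.Reasoning.Setoid setoid

  divisorSum : (ℕ → ℕ → Carrier) → ℕ → Carrier
  divisorSum f n = ∑ 1 n λ u → ∑ 1 n λ v → 𝟙 (u ℕ.* v ≡ᵇ n) * f u v

  ∑⁴ : ℕ → (ℕ → ℕ → ℕ → ℕ → Carrier) → Carrier
  ∑⁴ n F = ∑ 1 n λ a → ∑ 1 n λ b → ∑ 1 n λ c → ∑ 1 n λ d → F a b c d

  pairSum : (ℕ → ℕ → Carrier) → ℕ → Carrier
  pairSum g n = ∑⁴ n λ u₁ u₂ v₁ v₂ → 𝟙 (u₁ ℕ.* v₁ ℕ.+ u₂ ℕ.* v₂ ≡ᵇ n) * g v₁ v₂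

  orderedPairSum : (ℕ → ℕ → Carrier) → ℕ → Carrier
  orderedPairSum g n = ∑⁴ n λ u₁ u₂ v₁ v₂ → 𝟙 ((u₁ ℕ.* v₁ ℕ.+ u₂ ℕ.* v₂ ≡ᵇ n) ∧ (u₂ <ᵇ u₁)) * g v₁ v₂

  ∑⁴-cong : ∀ n {F G : ℕ → ℕ → ℕ → ℕ → Carrier} → (∀ a b c d → F a b c d ≈ G a b c d) → ∑⁴ n F ≈ ∑⁴ n G
  ∑⁴-cong n F≈G = ∑-cong 1 n λ a → ∑-cong 1 n λ b → ∑-cong 1 n λ c → ∑-cong 1 n λ d → F≈G a b c d

  ∑⁴-distrib-+ : ∀ n (F G : ℕ → ℕ → ℕ → ℕ → Carrier) →
                 ∑⁴ n (λ a b c d → F a b c d + G a b c d) ≈ ∑⁴ n F + ∑⁴ n G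
  ∑⁴-distrib-+ n F G =
    trans (∑-cong 1 n λ a → trans (∑-cong 1 n λ b → trans (∑-cong 1 n λ c → ∑-distrib-+ 1 n _ _)
                                                          (∑-distrib-+ 1 n _ _))
                                  (∑-distrib-+ 1 n _ _))
          (∑-distrib-+ 1 n _ _)

  ∑-∑⁴ : ∀ m k n (F : ℕ → ℕ → ℕ → ℕ → ℕ → Carrier) →
         ∑ m k (λ j → ∑⁴ n (F j)) ≈ ∑⁴ n (λ a b c d → ∑ m k (λ j → F j a b c d))
  ∑-∑⁴ m k n F =
    trans (∑-comm m k 1 n _) (∑-cong 1 n λ a → trans (∑-comm m k 1 n _) (∑-cong 1 n λ b →
      trans (∑-comm m k 1 n _) (∑-cong 1 n λ c → ∑-comm m k 1 n _)))

  ∑³-rotate : ∀ n (F : ℕ → ℕ → ℕ → Carrier) →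
              (∑ 1 n λ a → ∑ 1 n λ b → ∑ 1 n λ c → F a b c) ≈ (∑ 1 n λ b → ∑ 1 n λ c → ∑ 1 n λ a → F a b c)
  ∑³-rotate n F = trans (∑-comm 1 n 1 n _) (∑-cong 1 n λ b → ∑-comm 1 n 1 n _)

  ∑⁴-rotate : ∀ n (F : ℕ → ℕ → ℕ → ℕ → Carrier) →
              ∑⁴ n F ≈ (∑ 1 n λ b → ∑ 1 n λ c → ∑ 1 n λ d → ∑ 1 n λ a → F a b c d)
  ∑⁴-rotate n F = trans (∑-comm 1 n 1 n _) (∑-cong 1 n λ b → ∑³-rotate n (λ a → F a b))

  ∑⁴-swap : ∀ n (F : ℕ → ℕ → ℕ → ℕ → Carrier) → ∑⁴ n F ≈ ∑⁴ n (λ a b c d → F b a d c)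
  ∑⁴-swap n F = trans (∑-comm 1 n 1 n _) (∑-cong 1 n λ b → ∑-cong 1 n λ a → ∑-comm 1 n 1 n _)

  divisorSum-cong : ∀ n {f g : ℕ → ℕ → Carrier} → (∀ u v → 1 ≤ u → f u v ≈ g u v) →
                    divisorSum f n ≈ divisorSum g n
  divisorSum-cong n f≈g = ∑-cong-< 1 n λ u 1≤u _ → ∑-cong 1 n λ v → *-congˡ (f≈g u v 1≤u)

  divisorSum-distrib-+ : ∀ n (f g : ℕ → ℕ → Carrier) →
                         divisorSum (λ u v → f u v + g u v) n ≈ divisorSum f n + divisorSum g n
  divisorSum-distrib-+ n f g =
    trans (∑-cong 1 n λ u → trans (∑-cong 1 n λ v → distribˡ _ _ _) (∑-distrib-+ 1 n _ _)) (∑-distrib-+ 1 n _ _)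

  *-divisorSum : ∀ (φ : ℕ → Carrier) f n → φ n * divisorSum f n ≈ divisorSum (λ u v → φ (u ℕ.* v) * f u v) n
  *-divisorSum φ f n =
    trans (*-distribˡ-∑ 1 n _ _) (∑-cong 1 n λ u → trans (*-distribˡ-∑ 1 n _ _) (∑-cong 1 n λ v → move-φ _ _))
    where
    move-φ : ∀ m x → φ n * (𝟙 (m ≡ᵇ n) * x) ≈ 𝟙 (m ≡ᵇ n) * (φ m * x)
    move-φ m x = begin
      φ n * (𝟙 (m ≡ᵇ n) * x)    ≈⟨ x∙yz≈y∙xz _ _ _ ⟩
      𝟙 (m ≡ᵇ n) * (φ n * x)    ≈⟨ *-assoc _ _ _ ⟨
      𝟙 (m ≡ᵇ n) * φ n * x      ≈⟨ *-congʳ (𝟙-≡ᵇ-subst φ m n) ⟨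
      𝟙 (m ≡ᵇ n) * φ m * x      ≈⟨ *-assoc _ _ _ ⟩
      𝟙 (m ≡ᵇ n) * (φ m * x)    ∎

  divisorSum-extend : ∀ {k n} (f : ℕ → ℕ → Carrier) → k ≤ n →
                      divisorSum f k ≈ (∑ 1 n λ u → ∑ 1 n λ v → 𝟙 (u ℕ.* v ≡ᵇ k) * f u v)
  divisorSum-extend {k} {n} f k≤n =
    trans (∑-cong-< 1 k λ u 1≤u _ → ∑-extend 1 _ k≤n λ v k+1≤v →
             𝟙-≡ᵇ-≢ (ℕ.>⇒≢ (ℕ.<-≤-trans (k<1+k k+1≤v) (ℕ.m≤n*m v u {{ℕ.>-nonZero 1≤u}}))) _)
          (∑-extend 1 _ k≤n λ u k+1≤u → ∑-zero 1 n λ v 1≤v _ →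
             𝟙-≡ᵇ-≢ (ℕ.>⇒≢ (ℕ.<-≤-trans (k<1+k k+1≤u) (ℕ.m≤m*n u v {{ℕ.>-nonZero 1≤v}}))) _)
    where
    k<1+k : ∀ {i} → k ℕ.+ 1 ≤ i → k < i
    k<1+k {i} = ≡.subst (_≤ i) (ℕ.+-comm k 1)

  ∑-convolution-𝟙 : ∀ n a b → ∑ 0 (suc n) (λ k → 𝟙 (a ≡ᵇ k) * 𝟙 (b ≡ᵇ n ∸ k)) ≈ 𝟙 (a ℕ.+ b ≡ᵇ n)
  ∑-convolution-𝟙 n a b with ℕ.≤-<-connex a n
  ... | inj₁ a≤n = trans (∑-delta 0 (suc n) _ z≤n (s≤s (≡.subst (a ≤_) (≡.sym (ℕ.+-identityʳ n)) a≤n))) (𝟙-cong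
          (λ b≡n∸a → ℕ.≡⇒≡ᵇ _ _ (≡.trans (≡.cong (a ℕ.+_) (ℕ.≡ᵇ⇒≡ b (n ∸ a) b≡n∸a)) (ℕ.m+[n∸m]≡n a≤n)))
          (λ a+b≡n → ℕ.≡⇒≡ᵇ _ _ (≡.trans (≡.sym (ℕ.m+n∸m≡n a b)) (≡.cong (_∸ a) (ℕ.≡ᵇ⇒≡ (a ℕ.+ b) n a+b≡n)))))
  ... | inj₂ n<a = trans (∑-delta-out 0 (suc n) _ (≡.subst (_≤ a) (≡.cong suc (≡.sym (ℕ.+-identityʳ n))) n<a))
          (sym (𝟙-false (ℕ.>⇒≢ (ℕ.<-≤-trans n<a (ℕ.m≤m+n a b)) ∘ ℕ.≡ᵇ⇒≡ (a ℕ.+ b) n)))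

  divisorSum-convolution : ∀ n (f g : ℕ → Carrier) →
    ∑ 0 (suc n) (λ k → divisorSum (λ _ → f) k * divisorSum (λ _ → g) (n ∸ k)) ≈ pairSum (λ x y → f x * g y) n
  divisorSum-convolution n f g = begin
    ∑ 0 (suc n) (λ k → divisorSum (λ _ → f) k * divisorSum (λ _ → g) (n ∸ k))
      ≈⟨ ∑-cong-< 0 (suc n) (λ k _ k<1+n → *-cong (divisorSum-extend _ (k≤n k<1+n)) (divisorSum-extend _ (ℕ.m∸n≤m n k))) ⟩
    ∑ 0 (suc n) (λ k → (∑ 1 n λ u₁ → ∑ 1 n λ v₁ → 𝟙 (u₁ ℕ.* v₁ ≡ᵇ k) * f v₁)
                     * (∑ 1 n λ u₂ → ∑ 1 n λ v₂ → 𝟙 (u₂ ℕ.* v₂ ≡ᵇ n ∸ k) * g v₂))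
      ≈⟨ ∑-cong 0 (suc n) (λ k → trans (∑-*-∑ 1 n 1 n _ _) (∑-cong 1 n λ u₁ → ∑-cong 1 n λ u₂ →
                                   trans (∑-*-∑ 1 n 1 n _ _) (∑-cong 1 n λ v₁ → ∑-cong 1 n λ v₂ → interchange _ _ _ _))) ⟩
    ∑ 0 (suc n) (λ k → ∑⁴ n λ u₁ u₂ v₁ v₂ → (𝟙 (u₁ ℕ.* v₁ ≡ᵇ k) * 𝟙 (u₂ ℕ.* v₂ ≡ᵇ n ∸ k)) * (f v₁ * g v₂))
      ≈⟨ ∑-∑⁴ 0 (suc n) n _ ⟩
    ∑⁴ n (λ u₁ u₂ v₁ v₂ → ∑ 0 (suc n) λ k → (𝟙 (u₁ ℕ.* v₁ ≡ᵇ k) * 𝟙 (u₂ ℕ.* v₂ ≡ᵇ n ∸ k)) * (f v₁ * g v₂))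
      ≈⟨ ∑⁴-cong n (λ u₁ u₂ v₁ v₂ → trans (sym (*-distribʳ-∑ 0 (suc n) _ _))
                                      (*-congʳ (∑-convolution-𝟙 n (u₁ ℕ.* v₁) (u₂ ℕ.* v₂)))) ⟩
    pairSum (λ x y → f x * g y) n
      ∎
    where
    k≤n : ∀ {k} → k < suc n ℕ.+ 0 → k ≤ n
    k≤n {k} k<1+n+0 = ℕ.s≤s⁻¹ (≡.subst (k <_) (ℕ.+-identityʳ (suc n)) k<1+n+0)

  pairSum-trichotomy : ∀ n (g : ℕ → ℕ → Carrier) →
    pairSum g n ≈ pairSum (λ x y → 𝟙 (x <ᵇ y) * g x y) n
                  + (pairSum (λ x y → 𝟙 (x ≡ᵇ y) * g x y) n + pairSum (λ x y → 𝟙 (y <ᵇ x) * g x y) n)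
  pairSum-trichotomy n g =
    trans (∑⁴-cong n (λ u₁ u₂ v₁ v₂ → trans (*-congˡ (split v₁ v₂)) (trans (distribˡ _ _ _) (+-congˡ (distribˡ _ _ _)))))
          (trans (∑⁴-distrib-+ n _ _) (+-congˡ (∑⁴-distrib-+ n _ _)))
    where
    split : ∀ x y → g x y ≈ 𝟙 (x <ᵇ y) * g x y + (𝟙 (x ≡ᵇ y) * g x y + 𝟙 (y <ᵇ x) * g x y)
    split x y = begin
      g x y                                                              ≈⟨ *-identityˡ _ ⟨
      1# * g x y                                                         ≈⟨ *-congʳ (𝟙-trichotomy x y) ⟨
      (𝟙 (x <ᵇ y) + (𝟙 (x ≡ᵇ y) + 𝟙 (y <ᵇ x))) * g x y                   ≈⟨ trans (distribʳ _ _ _) (+-congˡ (distribʳ _ _ _)) ⟩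
      𝟙 (x <ᵇ y) * g x y + (𝟙 (x ≡ᵇ y) * g x y + 𝟙 (y <ᵇ x) * g x y)     ∎

  pairSum-swap : ∀ n (g : ℕ → ℕ → Carrier) → pairSum g n ≈ pairSum (λ x y → g y x) n
  pairSum-swap n g = trans (∑⁴-swap n _) (∑⁴-cong n (λ u₁ u₂ v₁ v₂ →
    *-congʳ (reflexive (≡.cong (λ m → 𝟙 (m ≡ᵇ n)) (ℕ.+-comm (u₂ ℕ.* v₂) (u₁ ℕ.* v₁))))))

  pairSum-diagonal : ∀ n (g : ℕ → ℕ → Carrier) →
    pairSum (λ x y → 𝟙 (x ≡ᵇ y) * g x y) n ≈ divisorSum (λ U v → (U ∸ 1) × g v v) n
  pairSum-diagonal n g = begin
    pairSum (λ x y → 𝟙 (x ≡ᵇ y) * g x y) n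
      ≈⟨ (∑-cong 1 n λ u₁ → ∑-cong 1 n λ u₂ → ∑-cong-< 1 n λ v 1≤v v<n+1 →
            trans (∑-cong 1 n λ v₂ → x∙yz≈y∙xz _ _ _) (∑-delta 1 n _ 1≤v v<n+1)) ⟩
    (∑ 1 n λ u₁ → ∑ 1 n λ u₂ → ∑ 1 n λ v → 𝟙 (u₁ ℕ.* v ℕ.+ u₂ ℕ.* v ≡ᵇ n) * g v v)
      ≈⟨ ∑³-rotate n _ ⟩
    (∑ 1 n λ u₂ → ∑ 1 n λ v → ∑ 1 n λ u₁ → 𝟙 (u₁ ℕ.* v ℕ.+ u₂ ℕ.* v ≡ᵇ n) * g v v)
      ≈⟨ (∑-cong 1 n λ u₂ → ∑-cong-< 1 n λ v 1≤v _ →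
            trans (∑-cong 1 n λ u₁ → reflexive (≡.cong (λ m → 𝟙 (m ≡ᵇ n) * g v v) (regroup u₁ u₂ v)))
                  (sym (∑-shift n u₂ _ (λ U n<U → 𝟙-≡ᵇ-≢ (ℕ.>⇒≢ (ℕ.<-≤-trans n<U (ℕ.m≤m*n U v {{ℕ.>-nonZero 1≤v}}))) _)))) ⟩
    (∑ 1 n λ u₂ → ∑ 1 n λ v → ∑ 1 n λ U → 𝟙 (u₂ <ᵇ U) * (𝟙 (U ℕ.* v ≡ᵇ n) * g v v))
      ≈⟨ ∑³-rotate n _ ⟨
    (∑ 1 n λ U → ∑ 1 n λ u₂ → ∑ 1 n λ v → 𝟙 (u₂ <ᵇ U) * (𝟙 (U ℕ.* v ≡ᵇ n) * g v v))
      ≈⟨ (∑-cong-< 1 n λ U 1≤U U<n+1 → trans (∑-comm 1 n 1 n _) (∑-cong 1 n λ v →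
            trans (count U 1≤U U<n+1 _) (sym (×-comm-* (U ∸ 1) _ _)))) ⟩
    divisorSum (λ U v → (U ∸ 1) × g v v) n
      ∎
    where
    regroup : ∀ u₁ u₂ v → u₁ ℕ.* v ℕ.+ u₂ ℕ.* v ≡ (u₂ ℕ.+ u₁) ℕ.* v
    regroup = solve 3 (λ u₁ u₂ v → u₁ :* v :+ u₂ :* v := (u₂ :+ u₁) :* v) ≡.refl
      where open Data.Nat.Solver.+-*-Solver
    count : ∀ U → 1 ≤ U → U < n ℕ.+ 1 → ∀ x → ∑ 1 n (λ u → 𝟙 (u <ᵇ U) * x) ≈ (U ∸ 1) × x
    count U 1≤U U<n+1 x =
      trans (∑-cong 1 n (λ u → reflexive (≡.cong (λ b → 𝟙 (u <ᵇ b) * x) (≡.sym (ℕ.m+[n∸m]≡n 1≤U)))))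
            (∑-𝟙-<ᵇ 1 n x (ℕ.≤-trans (ℕ.m∸n≤m U 1) (ℕ.s≤s⁻¹ (≡.subst (U <_) (ℕ.+-comm n 1) U<n+1))))

  pairSum-upper : ∀ n (g : ℕ → ℕ → Carrier) →
    pairSum (λ x y → 𝟙 (x <ᵇ y) * g x y) n ≈ orderedPairSum (λ x w → g x (x ℕ.+ w)) n
  -- Substitute v₂ = v₁ + w, then U = u₁ + u₂.
  pairSum-upper n g = begin
    pairSum (λ x y → 𝟙 (x <ᵇ y) * g x y) n
      ≈⟨ (∑-cong 1 n λ u₁ → ∑-cong-< 1 n λ u₂ 1≤u₂ _ → ∑-cong 1 n λ v₁ →
            trans (∑-cong 1 n λ v₂ → x∙yz≈y∙xz _ _ _)
                  (∑-shift n v₁ _ (λ v₂ n<v₂ → 𝟙-≡ᵇ-≢ (ℕ.>⇒≢ (ℕ.<-≤-trans n<v₂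
                     (ℕ.≤-trans (ℕ.m≤n*m v₂ u₂ {{ℕ.>-nonZero 1≤u₂}}) (ℕ.m≤n+m (u₂ ℕ.* v₂) (u₁ ℕ.* v₁))))) _))) ⟩
    ∑⁴ n (λ u₁ u₂ v₁ w → 𝟙 (u₁ ℕ.* v₁ ℕ.+ u₂ ℕ.* (v₁ ℕ.+ w) ≡ᵇ n) * g v₁ (v₁ ℕ.+ w))
      ≈⟨ ∑⁴-rotate n _ ⟩
    (∑ 1 n λ u₂ → ∑ 1 n λ v₁ → ∑ 1 n λ w → ∑ 1 n λ u₁ → 𝟙 (u₁ ℕ.* v₁ ℕ.+ u₂ ℕ.* (v₁ ℕ.+ w) ≡ᵇ n) * g v₁ (v₁ ℕ.+ w))
      ≈⟨ (∑-cong 1 n λ u₂ → ∑-cong-< 1 n λ v₁ 1≤v₁ _ → ∑-cong 1 n λ w →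
            trans (∑-cong 1 n λ u₁ → reflexive (≡.cong (λ m → 𝟙 (m ≡ᵇ n) * g v₁ (v₁ ℕ.+ w)) (regroup u₁ u₂ v₁ w)))
                  (sym (∑-shift n u₂ _ (λ U n<U → 𝟙-≡ᵇ-≢ (ℕ.>⇒≢ (ℕ.<-≤-trans n<U
                     (ℕ.≤-trans (ℕ.m≤m*n U v₁ {{ℕ.>-nonZero 1≤v₁}}) (ℕ.m≤m+n _ _)))) _)))) ⟩
    (∑ 1 n λ u₂ → ∑ 1 n λ v₁ → ∑ 1 n λ w → ∑ 1 n λ U → 𝟙 (u₂ <ᵇ U) * (𝟙 (U ℕ.* v₁ ℕ.+ u₂ ℕ.* w ≡ᵇ n) * g v₁ (v₁ ℕ.+ w)))
      ≈⟨ ∑⁴-rotate n _ ⟨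
    ∑⁴ n (λ U u₂ v₁ w → 𝟙 (u₂ <ᵇ U) * (𝟙 (U ℕ.* v₁ ℕ.+ u₂ ℕ.* w ≡ᵇ n) * g v₁ (v₁ ℕ.+ w)))
      ≈⟨ ∑⁴-cong n (λ U u₂ v₁ w → trans (x∙yz≈y∙xz _ _ _) (trans (sym (*-assoc _ _ _))
                                    (*-congʳ (sym (𝟙-∧ (U ℕ.* v₁ ℕ.+ u₂ ℕ.* w ≡ᵇ n) (u₂ <ᵇ U)))))) ⟩
    orderedPairSum (λ x w → g x (x ℕ.+ w)) n
      ∎
    where
    regroup : ∀ u₁ u₂ v w → u₁ ℕ.* v ℕ.+ u₂ ℕ.* (v ℕ.+ w) ≡ (u₂ ℕ.+ u₁) ℕ.* v ℕ.+ u₂ ℕ.* w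
    regroup = solve 4 (λ u₁ u₂ v w → u₁ :* v :+ u₂ :* (v :+ w) := (u₂ :+ u₁) :* v :+ u₂ :* w) ≡.refl
      where open Data.Nat.Solver.+-*-Solver

  orderedPairSum-cong : ∀ n {g h : ℕ → ℕ → Carrier} → (∀ x y → g x y ≈ h x y) →
                        orderedPairSum g n ≈ orderedPairSum h n
  orderedPairSum-cong n g≈h = ∑⁴-cong n (λ _ _ x y → *-congˡ (g≈h x y))

  *-orderedPairSum : ∀ n x (g : ℕ → ℕ → Carrier) → x * orderedPairSum g n ≈ orderedPairSum (λ a b → x * g a b) n
  *-orderedPairSum n x g =
    trans (*-distribˡ-∑ 1 n x _) (∑-cong 1 n λ _ → trans (*-distribˡ-∑ 1 n x _) (∑-cong 1 n λ _ →
      trans (*-distribˡ-∑ 1 n x _) (∑-cong 1 n λ _ → trans (*-distribˡ-∑ 1 n x _) (∑-cong 1 n λ _ →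
        x∙yz≈y∙xz _ _ _))))

  ∑-orderedPairSum : ∀ m k n (g : ℕ → ℕ → ℕ → Carrier) →
    ∑ m k (λ j → orderedPairSum (g j) n) ≈ orderedPairSum (λ x y → ∑ m k (λ j → g j x y)) n
  ∑-orderedPairSum m k n g = trans (∑-∑⁴ m k n _) (∑⁴-cong n (λ _ _ _ _ → sym (*-distribˡ-∑ m k _ _)))

  pairSum-cong : ∀ n {g h : ℕ → ℕ → Carrier} → (∀ x y → g x y ≈ h x y) → pairSum g n ≈ pairSum h n
  pairSum-cong n g≈h = ∑⁴-cong n (λ _ _ x y → *-congˡ (g≈h x y))

module MultipleDivisorFunctions {ℓ₁ ℓ₂ : Level} (R : CommutativeRing ℓ₁ ℓ₂) (ι : ℚ → CommutativeRing.Carrier R)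
                                (ι-hom : IsRingHomomorphism +-*-rawRing (CommutativeRing.rawRing R) ι)
                                (η : CommutativeRing.Carrier R) where
  open CommutativeRing R
  open Series R ι η
  open IsRingHomomorphism ι-hom using (+-homo; *-homo; 0#-homo; 1#-homo)
  open Sums commutativeSemiring
  open DivisorSums commutativeSemiring
  open SemiringMult semiring using (_×_)
  open SemiringExp semiring using (_^_; ^-homo-*; ^-assocʳ)
  open CommutativeSemiringExp commutativeSemiring using (^-distrib-*)
  open CommutativeSemigroupProperties *-commutativeSemigroup using (interchange; x∙yz≈y∙xz)
  open import Algebra.Properties.Group (AbelianGroup.group +-abelianGroup) using (//-rightDividesʳ)
  open import Relation.Binary.Reasoning.Setoid setoid
  open import Algebra.Solver.Ring.NaturalCoefficients.Default commutativeSemiring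

  nat : ℕ → Carrier
  nat n = ι (natℚ n)

  inv : ℕ → Carrier
  inv n = ι (invℚ n)

  nat-+ : ∀ m n → nat (m ℕ.+ n) ≈ nat m + nat n
  nat-+ m n = trans (reflexive (≡.cong ι (natℚ-+ m n))) (+-homo _ _)

  nat-* : ∀ m n → nat (m ℕ.* n) ≈ nat m * nat n
  nat-* m n = trans (reflexive (≡.cong ι (natℚ-* m n))) (*-homo _ _)

  nat-∑ : ∀ m n (f : ℕ → ℕ) → nat (ℕ-Sums.∑ m n f) ≈ ∑ m n (λ i → nat (f i))
  nat-∑ m zero    f = 0#-homo
  nat-∑ m (suc n) f = trans (nat-+ (f m) _) (+-congˡ (nat-∑ (suc m) n f))

  ×≈nat* : ∀ n x → n × x ≈ nat n * x
  ×≈nat* zero    x = sym (trans (*-congʳ 0#-homo) (zeroˡ x))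
  ×≈nat* (suc n) x = begin
    x + n × x             ≈⟨ +-cong (sym (*-identityˡ x)) (×≈nat* n x) ⟩
    1# * x + nat n * x    ≈⟨ distribʳ x 1# (nat n) ⟨
    (1# + nat n) * x      ≈⟨ *-congʳ (trans (nat-+ 1 n) (+-congʳ 1#-homo)) ⟨
    nat (suc n) * x       ∎

  inv-*-nat : ∀ {m} → 1 ≤ m → inv m * nat m ≈ 1#
  inv-*-nat {suc m} _ = trans (sym (*-homo _ _)) (trans (reflexive (≡.cong ι (invℚ-*-natℚ m))) 1#-homo)

  nat-*-inv : ∀ {a m k P} → a ℕ.* (m ℕ.* k) ≡ P → 1 ≤ m → 1 ≤ k → 1 ≤ P → nat a * inv P ≈ inv m * inv k
  nat-*-inv {a} {m} {k} {P} a*m*k≡P 1≤m 1≤k 1≤P = begin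
    nat a * inv P
      ≈⟨ *-identityʳ _ ⟨
    nat a * inv P * 1#
      ≈⟨ *-congˡ (trans (*-cong (inv-*-nat 1≤m) (inv-*-nat 1≤k)) (*-identityˡ 1#)) ⟨
    nat a * inv P * ((inv m * nat m) * (inv k * nat k))
      ≈⟨ solve 6 (λ A IP Im Km Ik Kk → A :* IP :* ((Im :* Km) :* (Ik :* Kk)) := (IP :* (A :* (Km :* Kk))) :* (Im :* Ik))
                 refl _ _ _ _ _ _ ⟩
    (inv P * (nat a * (nat m * nat k))) * (inv m * inv k)
      ≈⟨ *-congʳ (*-congˡ (trans (*-congˡ (sym (nat-* m k))) (sym (nat-* a _)))) ⟩
    (inv P * nat (a ℕ.* (m ℕ.* k))) * (inv m * inv k)
      ≡⟨ ≡.cong (λ n → (inv P * nat n) * (inv m * inv k)) a*m*k≡P ⟩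
    (inv P * nat P) * (inv m * inv k)
      ≈⟨ trans (*-congʳ (inv-*-nat 1≤P)) (*-identityˡ _) ⟩
    inv m * inv k
      ∎

  inv-* : ∀ {m k} → 1 ≤ m → 1 ≤ k → inv (m ℕ.* k) ≈ inv m * inv k
  inv-* {m} {k} 1≤m 1≤k =
    trans (sym (trans (*-congʳ 1#-homo) (*-identityˡ _)))
          (nat-*-inv {1} {m} {k} (ℕ.*-identityˡ (m ℕ.* k)) 1≤m 1≤k (ℕ.*-mono-≤ 1≤m 1≤k))

  nCk*n!⁻¹≈k!⁻¹*[n∸k]!⁻¹ : ∀ {n k} → k ≤ n → nat (n C k) * inv (n !) ≈ inv (k !) * inv ((n ∸ k) !)
  nCk*n!⁻¹≈k!⁻¹*[n∸k]!⁻¹ {n} {k} k≤n =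
    nat-*-inv {n C k} nCk*k!*[n∸k]!≡n! (ℕ.1≤n! k) (ℕ.1≤n! (n ∸ k)) (ℕ.1≤n! n)
    where
    nCk*k!*[n∸k]!≡n! : (n C k) ℕ.* (k ! ℕ.* (n ∸ k) !) ≡ n !
    nCk*k!*[n∸k]!≡n! = ≡.trans (≡.cong (ℕ._* (k ! ℕ.* (n ∸ k) !)) (nCk≡n!/k![n-k]! k≤n))
                               (m/n*n≡m {{k ℕ.!* (n ∸ k) !≢0}} (k![n∸k]!∣n! k≤n))

  p!⁻¹*q!⁻¹≈sCp*s!⁻¹ : ∀ {p q s} → p ℕ.+ q ≡ s → inv (p !) * inv (q !) ≈ nat (s C p) * inv (s !)
  p!⁻¹*q!⁻¹≈sCp*s!⁻¹ {p} {q} {s} p+q≡s =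
    sym (trans (nCk*n!⁻¹≈k!⁻¹*[n∸k]!⁻¹ (≡.subst (p ≤_) p+q≡s (ℕ.m≤m+n p q)))
               (*-congˡ (reflexive (≡.cong (λ t → inv (t !)) s∸p≡q))))
    where
    s∸p≡q : s ∸ p ≡ q
    s∸p≡q = ≡.trans (≡.cong (_∸ p) (≡.sym p+q≡s)) (ℕ.m+n∸m≡n p q)

  [p+i]Cp*[p+i]!⁻¹*[q∸i]!⁻¹≈p!⁻¹*q!⁻¹*qCi : ∀ p q i → i ≤ q →
    nat ((p ℕ.+ i) C p) * (inv ((p ℕ.+ i) !) * inv ((q ∸ i) !)) ≈ inv (p !) * inv (q !) * nat (q C i)
  [p+i]Cp*[p+i]!⁻¹*[q∸i]!⁻¹≈p!⁻¹*q!⁻¹*qCi p q i i≤q = begin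
    nat ((p ℕ.+ i) C p) * (inv ((p ℕ.+ i) !) * inv ((q ∸ i) !))  ≈⟨ *-assoc _ _ _ ⟨
    nat ((p ℕ.+ i) C p) * inv ((p ℕ.+ i) !) * inv ((q ∸ i) !)    ≈⟨ *-congʳ (nCk*n!⁻¹≈k!⁻¹*[n∸k]!⁻¹ (ℕ.m≤m+n p i)) ⟩
    inv (p !) * inv ((p ℕ.+ i ∸ p) !) * inv ((q ∸ i) !)          ≡⟨ ≡.cong (λ j → inv (p !) * inv (j !) * inv ((q ∸ i) !)) (ℕ.m+n∸m≡n p i) ⟩
    inv (p !) * inv (i !) * inv ((q ∸ i) !)                      ≈⟨ *-assoc _ _ _ ⟩
    inv (p !) * (inv (i !) * inv ((q ∸ i) !))                    ≈⟨ *-congˡ (nCk*n!⁻¹≈k!⁻¹*[n∸k]!⁻¹ i≤q) ⟨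
    inv (p !) * (nat (q C i) * inv (q !))                        ≈⟨ *-congˡ (*-comm _ _) ⟩
    inv (p !) * (inv (q !) * nat (q C i))                        ≈⟨ *-assoc _ _ _ ⟨
    inv (p !) * inv (q !) * nat (q C i)                          ∎

  binomial-identity : ∀ {p q s} → p ℕ.+ q ≡ s → ∀ x y →
    inv (p !) * inv (q !) * nat (x ℕ.^ p ℕ.* (x ℕ.+ y) ℕ.^ q)
    ≈ ∑ 0 (suc s) (λ j → nat (j C p) * (inv (j !) * inv ((s ∸ j) !)) * nat (x ℕ.^ j ℕ.* y ℕ.^ (s ∸ j)))
  binomial-identity {p} {q} {s} p+q≡s x y = sym (begin
    ∑ 0 (suc s) term
      ≈⟨ ∑-drop 0 p (suc s) term (λ j _ j<p+0 → term-below-p j (≡.subst (j <_) (ℕ.+-identityʳ p) j<p+0)) ⟩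
    ∑ (p ℕ.+ 0) (suc s ∸ p) term
      ≡⟨ ∑-translate p 0 (suc s ∸ p) term ⟩
    ∑ 0 (suc s ∸ p) (λ i → term (p ℕ.+ i))
      ≡⟨ ≡.cong (λ m → ∑ 0 m (λ i → term (p ℕ.+ i))) 1+s∸p≡1+q ⟩
    ∑ 0 (suc q) (λ i → term (p ℕ.+ i))
      ≈⟨ ∑-cong-< 0 (suc q) (λ i _ i<1+q → term-shifted i (ℕ.s≤s⁻¹ (≡.subst (i <_) (ℕ.+-identityʳ (suc q)) i<1+q))) ⟩
    ∑ 0 (suc q) (λ i → cpq * nat (x ℕ.^ p ℕ.* binomialTerm i))
      ≈⟨ *-distribˡ-∑ 0 (suc q) cpq (λ i → nat (x ℕ.^ p ℕ.* binomialTerm i)) ⟨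
    cpq * ∑ 0 (suc q) (λ i → nat (x ℕ.^ p ℕ.* binomialTerm i))
      ≈⟨ *-congˡ (nat-∑ 0 (suc q) (λ i → x ℕ.^ p ℕ.* binomialTerm i)) ⟨
    cpq * nat (ℕ-Sums.∑ 0 (suc q) (λ i → x ℕ.^ p ℕ.* binomialTerm i))
      ≡⟨ ≡.cong (λ m → cpq * nat m) (ℕ-Sums.*-distribˡ-∑ 0 (suc q) (x ℕ.^ p) binomialTerm) ⟨
    cpq * nat (x ℕ.^ p ℕ.* ℕ-Sums.∑ 0 (suc q) binomialTerm)
      ≡⟨ ≡.cong (λ m → cpq * nat (x ℕ.^ p ℕ.* m)) (binomial-theoremℕ q x y) ⟨
    cpq * nat (x ℕ.^ p ℕ.* (x ℕ.+ y) ℕ.^ q)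
      ∎)
    where
    cpq = inv (p !) * inv (q !)
    term : ℕ → Carrier
    term j = nat (j C p) * (inv (j !) * inv ((s ∸ j) !)) * nat (x ℕ.^ j ℕ.* y ℕ.^ (s ∸ j))
    term-below-p : ∀ j → j < p → term j ≈ 0#
    term-below-p j j<p = begin
      nat (j C p) * (inv (j !) * inv ((s ∸ j) !)) * nat (x ℕ.^ j ℕ.* y ℕ.^ (s ∸ j))
        ≡⟨ ≡.cong (λ c → nat c * (inv (j !) * inv ((s ∸ j) !)) * nat (x ℕ.^ j ℕ.* y ℕ.^ (s ∸ j))) (k>n⇒nCk≡0 j<p) ⟩
      nat 0 * (inv (j !) * inv ((s ∸ j) !)) * nat (x ℕ.^ j ℕ.* y ℕ.^ (s ∸ j))
        ≈⟨ trans (*-congʳ (trans (*-congʳ 0#-homo) (zeroˡ _))) (zeroˡ _) ⟩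
      0#
        ∎
    module ℕ-* = CommutativeSemigroupProperties ℕ.*-commutativeSemigroup
    binomialTerm : ℕ → ℕ
    binomialTerm i = (q C i) ℕ.* (x ℕ.^ i ℕ.* y ℕ.^ (q ∸ i))
    s∸p≡q : s ∸ p ≡ q
    s∸p≡q = ≡.trans (≡.cong (_∸ p) (≡.sym p+q≡s)) (ℕ.m+n∸m≡n p q)
    1+s∸p≡1+q : suc s ∸ p ≡ suc q
    1+s∸p≡1+q = ≡.trans (ℕ.+-∸-assoc 1 (≡.subst (p ≤_) p+q≡s (ℕ.m≤m+n p q))) (≡.cong suc s∸p≡q)
    s∸[p+i]≡q∸i : ∀ i → s ∸ (p ℕ.+ i) ≡ q ∸ i
    s∸[p+i]≡q∸i i = ≡.trans (≡.cong (_∸ (p ℕ.+ i)) (≡.sym p+q≡s)) (ℕ.[m+n]∸[m+o]≡n∸o p q i)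
    term-shifted : ∀ i → i ≤ q → term (p ℕ.+ i) ≈ cpq * nat (x ℕ.^ p ℕ.* binomialTerm i)
    term-shifted i i≤q = begin
      term (p ℕ.+ i)
        ≡⟨ ≡.cong (λ m → nat ((p ℕ.+ i) C p) * (inv ((p ℕ.+ i) !) * inv (m !)) * nat (x ℕ.^ (p ℕ.+ i) ℕ.* y ℕ.^ m))
                  (s∸[p+i]≡q∸i i) ⟩
      nat ((p ℕ.+ i) C p) * (inv ((p ℕ.+ i) !) * inv ((q ∸ i) !)) * nat (x ℕ.^ (p ℕ.+ i) ℕ.* y ℕ.^ (q ∸ i))
        ≈⟨ *-cong ([p+i]Cp*[p+i]!⁻¹*[q∸i]!⁻¹≈p!⁻¹*q!⁻¹*qCi p q i i≤q)
                  (reflexive (≡.cong nat (≡.trans (≡.cong (ℕ._* y ℕ.^ (q ∸ i)) (ℕ.^-distribˡ-+-* x p i)) (ℕ.*-assoc (x ℕ.^ p) _ _)))) ⟩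
      cpq * nat (q C i) * nat (x ℕ.^ p ℕ.* (x ℕ.^ i ℕ.* y ℕ.^ (q ∸ i)))
        ≈⟨ trans (*-assoc _ _ _) (*-congˡ (sym (nat-* (q C i) (x ℕ.^ p ℕ.* (x ℕ.^ i ℕ.* y ℕ.^ (q ∸ i)))))) ⟩
      cpq * nat ((q C i) ℕ.* (x ℕ.^ p ℕ.* (x ℕ.^ i ℕ.* y ℕ.^ (q ∸ i))))
        ≡⟨ ≡.cong (λ m → cpq * nat m) (ℕ-*.x∙yz≈y∙xz (q C i) (x ℕ.^ p) (x ℕ.^ i ℕ.* y ℕ.^ (q ∸ i))) ⟩
      cpq * nat (x ℕ.^ p ℕ.* binomialTerm i)
        ∎

  pow≡^ : ∀ x n → pow x n ≡ x ^ n
  pow≡^ x zero    = ≡.refl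
  pow≡^ x (suc n) = ≡.cong (x *_) (pow≡^ x n)

  pow-+ : ∀ x m n → pow x (m ℕ.+ n) ≈ pow x m * pow x n
  pow-+ x m n = begin
    pow x (m ℕ.+ n)      ≡⟨ pow≡^ x (m ℕ.+ n) ⟩
    x ^ (m ℕ.+ n)        ≈⟨ ^-homo-* x m n ⟩
    x ^ m * x ^ n        ≡⟨ ≡.cong₂ _*_ (pow≡^ x m) (pow≡^ x n) ⟨
    pow x m * pow x n    ∎

  pow-* : ∀ x m n → pow x (m ℕ.* n) ≈ pow (pow x m) n
  pow-* x m n = begin
    pow x (m ℕ.* n)      ≡⟨ pow≡^ x (m ℕ.* n) ⟩
    x ^ (m ℕ.* n)        ≈⟨ ^-assocʳ x m n ⟨
    (x ^ m) ^ n          ≡⟨ ≡.cong (_^ n) (pow≡^ x m) ⟨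
    (pow x m) ^ n        ≡⟨ pow≡^ (pow x m) n ⟨
    pow (pow x m) n      ∎

  pow-distrib-* : ∀ x y n → pow (x * y) n ≈ pow x n * pow y n
  pow-distrib-* x y n = begin
    pow (x * y) n        ≡⟨ pow≡^ (x * y) n ⟩
    (x * y) ^ n          ≈⟨ ^-distrib-* x y n ⟩
    x ^ n * y ^ n        ≡⟨ ≡.cong₂ _*_ (pow≡^ x n) (pow≡^ y n) ⟨
    pow x n * pow y n    ∎

  pow-cong : ∀ {x y} n → x ≈ y → pow x n ≈ pow y n
  pow-cong zero    x≈y = refl
  pow-cong (suc n) x≈y = *-cong x≈y (pow-cong n x≈y)

  pow-1# : ∀ n → pow 1# n ≈ 1#
  pow-1# zero    = refl
  pow-1# (suc n) = trans (*-identityˡ _) (pow-1# n)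

  module _ (N : ℕ) .{{_ : NonZero N}} (ηᴺ≈1 : pow η N ≈ 1#) where

    pow-% : ∀ m → pow η (m % N) ≈ pow η m
    pow-% m = begin
      pow η (m % N)                         ≈⟨ *-identityʳ _ ⟨
      pow η (m % N) * 1#                    ≈⟨ *-congˡ ηᵏᴺ≈1 ⟨
      pow η (m % N) * pow η (m / N ℕ.* N)   ≈⟨ pow-+ η (m % N) _ ⟨
      pow η (m % N ℕ.+ m / N ℕ.* N)         ≡⟨ ≡.cong (pow η) (m≡m%n+[m/n]*n m N) ⟨
      pow η m                               ∎
      where
      ηᵏᴺ≈1 : pow η (m / N ℕ.* N) ≈ 1#
      ηᵏᴺ≈1 = trans (reflexive (≡.cong (pow η) (ℕ.*-comm (m / N) N)))
                    (trans (pow-* η N (m / N)) (trans (pow-cong (m / N) ηᴺ≈1) (pow-1# (m / N))))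

    pow-addMod : ∀ (α β : Fin N) v → pow η (toℕ (addMod N α β) ℕ.* v) ≈ pow η (toℕ α ℕ.* v) * pow η (toℕ β ℕ.* v)
    pow-addMod α β v = begin
      pow η (toℕ (addMod N α β) ℕ.* v)             ≈⟨ pow-* η (toℕ (addMod N α β)) v ⟩
      pow (pow η (toℕ (addMod N α β))) v           ≡⟨ ≡.cong (λ k → pow (pow η k) v) (toℕ-fromℕ< (m%n<n (toℕ α ℕ.+ toℕ β) N)) ⟩
      pow (pow η ((toℕ α ℕ.+ toℕ β) % N)) v        ≈⟨ pow-cong v (trans (pow-% _) (pow-+ η (toℕ α) (toℕ β))) ⟩
      pow (pow η (toℕ α) * pow η (toℕ β)) v        ≈⟨ pow-distrib-* _ _ v ⟩
      pow (pow η (toℕ α)) v * pow (pow η (toℕ β)) v ≈⟨ *-cong (pow-* η (toℕ α) v) (pow-* η (toℕ β) v) ⟨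
      pow η (toℕ α ℕ.* v) * pow η (toℕ β ℕ.* v)    ∎

  Σ1≡∑ : ∀ n (f : ℕ → Carrier) → Σ1 n f ≡ ∑ 1 n f
  Σ1≡∑ n f = ≡.trans (≡.cong (λ xs → sumL (map f xs)) (map-applyUpTo id suc n))
            (≡.trans (≡.cong sumL (map-applyUpTo suc f n))
            (≡.trans (foldr-applyUpTo n (λ i → f (suc i))) (≡.sym (∑-suc 0 n f))))

  ⋆≡∑ : ∀ (f g : QSeries) n → (f ⋆ g) n ≡ ∑ 0 (suc n) (λ k → f k * g (n ∸ k))
  ⋆≡∑ f g n = ≡.trans (≡.cong sumL (map-applyUpTo id _ (suc n))) (foldr-applyUpTo (suc n) _)

  weight : ℕ → ℕ → ℕ → Carrier
  weight a p v = pow η (a ℕ.* v) * nat (v ℕ.^ p)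

  div1≈divisorSum : ∀ {N} s (α : Fin N) n → div1 s α n ≈ inv ((s ∸ 1) !) * divisorSum (λ _ → weight (toℕ α) (s ∸ 1)) n
  div1≈divisorSum s α n = *-congˡ (trans (reflexive (Σ1≡∑ n _)) (∑-cong 1 n λ u →
    trans (reflexive (Σ1≡∑ n _)) (∑-cong 1 n λ v → if≈𝟙* _ _)))

  div2≈orderedPairSum : ∀ {N} s₁ s₂ (α₁ α₂ : Fin N) n →
    div2 s₁ s₂ α₁ α₂ n ≈ ι (invℚ ((s₁ ∸ 1) !) ℚ.* invℚ ((s₂ ∸ 1) !))
                         * orderedPairSum (λ v₁ v₂ → pow η (toℕ α₁ ℕ.* v₁ ℕ.+ toℕ α₂ ℕ.* v₂)
                                                     * nat (v₁ ℕ.^ (s₁ ∸ 1) ℕ.* v₂ ℕ.^ (s₂ ∸ 1))) n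
  div2≈orderedPairSum s₁ s₂ α₁ α₂ n = *-congˡ (trans (reflexive (Σ1≡∑ n _)) (∑-cong 1 n λ _ →
    trans (reflexive (Σ1≡∑ n _)) (∑-cong 1 n λ _ → trans (reflexive (Σ1≡∑ n _)) (∑-cong 1 n λ _ →
      trans (reflexive (Σ1≡∑ n _)) (∑-cong 1 n λ _ → if≈𝟙* _ _)))))

  orderedPairSum≈div2 : ∀ {N} (α₁ α₂ : Fin N) s j n →
    inv (j !) * inv ((s ∸ j) !) * orderedPairSum (λ x w → pow η (toℕ α₁ ℕ.* x ℕ.+ toℕ α₂ ℕ.* w) * nat (x ℕ.^ j ℕ.* w ℕ.^ (s ∸ j))) n
    ≈ div2 (suc j) (s ℕ.+ 2 ∸ suc j) α₁ α₂ n
  orderedPairSum≈div2 α₁ α₂ s j n = begin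
    inv (j !) * inv ((s ∸ j) !) * orderedPairSum (term (s ∸ j)) n
      ≈⟨ *-congʳ (*-homo _ _) ⟨
    ι (invℚ (j !) ℚ.* invℚ ((s ∸ j) !)) * orderedPairSum (term (s ∸ j)) n
      ≡⟨ ≡.cong (λ t → ι (invℚ (j !) ℚ.* invℚ (t !)) * orderedPairSum (term t) n) s+2∸[1+j]∸1≡s∸j ⟨
    ι (invℚ (j !) ℚ.* invℚ ((s ℕ.+ 2 ∸ suc j ∸ 1) !)) * orderedPairSum (term (s ℕ.+ 2 ∸ suc j ∸ 1)) n
      ≈⟨ div2≈orderedPairSum (suc j) (s ℕ.+ 2 ∸ suc j) α₁ α₂ n ⟨
    div2 (suc j) (s ℕ.+ 2 ∸ suc j) α₁ α₂ n
      ∎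
    where
    term : ℕ → ℕ → ℕ → Carrier
    term t x w = pow η (toℕ α₁ ℕ.* x ℕ.+ toℕ α₂ ℕ.* w) * nat (x ℕ.^ j ℕ.* w ℕ.^ t)
    s+2∸[1+j]∸1≡s∸j : s ℕ.+ 2 ∸ suc j ∸ 1 ≡ s ∸ j
    s+2∸[1+j]∸1≡s∸j = ≡.trans (≡.cong (λ t → t ∸ suc j ∸ 1) (ℕ.+-comm s 2))
                        (≡.trans (ℕ.∸-+-assoc (suc s) j 1) (≡.cong (suc s ∸_) (ℕ.+-comm j 1)))

  div1⋆div1 : ∀ {N} s₁ s₂ (α β : Fin N) n →
    (div1 s₁ α ⋆ div1 s₂ β) n
    ≈ inv ((s₁ ∸ 1) !) * inv ((s₂ ∸ 1) !) * pairSum (λ x y → weight (toℕ α) (s₁ ∸ 1) x * weight (toℕ β) (s₂ ∸ 1) y) n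
  div1⋆div1 s₁ s₂ α β n = begin
    (div1 s₁ α ⋆ div1 s₂ β) n
      ≡⟨ ⋆≡∑ (div1 s₁ α) (div1 s₂ β) n ⟩
    ∑ 0 (suc n) (λ k → div1 s₁ α k * div1 s₂ β (n ∸ k))
      ≈⟨ ∑-cong 0 (suc n) (λ k → trans (*-cong (div1≈divisorSum s₁ α k) (div1≈divisorSum s₂ β (n ∸ k))) (interchange _ _ _ _)) ⟩
    ∑ 0 (suc n) (λ k → (c₁ * c₂) * (divisorSum (λ _ → f) k * divisorSum (λ _ → g) (n ∸ k)))
      ≈⟨ *-distribˡ-∑ 0 (suc n) (c₁ * c₂) _ ⟨
    (c₁ * c₂) * ∑ 0 (suc n) (λ k → divisorSum (λ _ → f) k * divisorSum (λ _ → g) (n ∸ k))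
      ≈⟨ *-congˡ (divisorSum-convolution n f g) ⟩
    c₁ * c₂ * pairSum (λ x y → f x * g y) n
      ∎
    where
    c₁ = inv ((s₁ ∸ 1) !)
    c₂ = inv ((s₂ ∸ 1) !)
    f = weight (toℕ α) (s₁ ∸ 1)
    g = weight (toℕ β) (s₂ ∸ 1)

  module Decomposition {N} (α β γ : Fin N)
                       (ηᵞ≈ηᵅηᵝ : ∀ v → pow η (toℕ γ ℕ.* v) ≈ pow η (toℕ α ℕ.* v) * pow η (toℕ β ℕ.* v)) where

    private
      a = toℕ α
      b = toℕ β
      g = toℕ γ

    weight-* : ∀ {p q s} → p ℕ.+ q ≡ s → ∀ v → weight a p v * weight b q v ≈ weight g s v
    weight-* {p} {q} {s} p+q≡s v = begin
      pow η (a ℕ.* v) * nat (v ℕ.^ p) * (pow η (b ℕ.* v) * nat (v ℕ.^ q))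
        ≈⟨ interchange _ _ _ _ ⟩
      pow η (a ℕ.* v) * pow η (b ℕ.* v) * (nat (v ℕ.^ p) * nat (v ℕ.^ q))
        ≈⟨ *-cong (sym (ηᵞ≈ηᵅηᵝ v)) (sym (nat-* (v ℕ.^ p) (v ℕ.^ q))) ⟩
      pow η (g ℕ.* v) * nat (v ℕ.^ p ℕ.* v ℕ.^ q)
        ≡⟨ ≡.cong (λ t → pow η (g ℕ.* v) * nat t) (≡.trans (≡.sym (ℕ.^-distribˡ-+-* v p q)) (≡.cong (v ℕ.^_) p+q≡s)) ⟩
      pow η (g ℕ.* v) * nat (v ℕ.^ s)
        ∎

    pow-ax*pow-b[x+w] : ∀ x w → pow η (a ℕ.* x) * pow η (b ℕ.* (x ℕ.+ w)) ≈ pow η (g ℕ.* x ℕ.+ b ℕ.* w)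
    pow-ax*pow-b[x+w] x w = begin
      pow η (a ℕ.* x) * pow η (b ℕ.* (x ℕ.+ w))               ≡⟨ ≡.cong (λ e → pow η (a ℕ.* x) * pow η e) (ℕ.*-distribˡ-+ b x w) ⟩
      pow η (a ℕ.* x) * pow η (b ℕ.* x ℕ.+ b ℕ.* w)           ≈⟨ *-congˡ (pow-+ η (b ℕ.* x) (b ℕ.* w)) ⟩
      pow η (a ℕ.* x) * (pow η (b ℕ.* x) * pow η (b ℕ.* w))   ≈⟨ *-assoc _ _ _ ⟨
      pow η (a ℕ.* x) * pow η (b ℕ.* x) * pow η (b ℕ.* w)     ≈⟨ *-congʳ (ηᵞ≈ηᵅηᵝ x) ⟨
      pow η (g ℕ.* x) * pow η (b ℕ.* w)                       ≈⟨ pow-+ η (g ℕ.* x) (b ℕ.* w) ⟨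
      pow η (g ℕ.* x ℕ.+ b ℕ.* w)                             ∎

    weight-binomial : ∀ {p q s} → p ℕ.+ q ≡ s → ∀ x w →
      inv (p !) * inv (q !) * (weight a p x * weight b q (x ℕ.+ w))
      ≈ ∑ 0 (suc s) (λ j → nat (j C p) * (inv (j !) * inv ((s ∸ j) !))
                           * (pow η (g ℕ.* x ℕ.+ b ℕ.* w) * nat (x ℕ.^ j ℕ.* w ℕ.^ (s ∸ j))))
    weight-binomial {p} {q} {s} p+q≡s x w = begin
      inv (p !) * inv (q !) * (weight a p x * weight b q (x ℕ.+ w))
        ≈⟨ solve 5 (λ c e₁ n₁ e₂ n₂ → c :* ((e₁ :* n₁) :* (e₂ :* n₂)) := (e₁ :* e₂) :* (c :* (n₁ :* n₂))) refl _ _ _ _ _ ⟩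
      pow η (a ℕ.* x) * pow η (b ℕ.* (x ℕ.+ w)) * (inv (p !) * inv (q !) * (nat (x ℕ.^ p) * nat ((x ℕ.+ w) ℕ.^ q)))
        ≈⟨ *-cong (pow-ax*pow-b[x+w] x w) (*-congˡ (sym (nat-* (x ℕ.^ p) ((x ℕ.+ w) ℕ.^ q)))) ⟩
      pow η (g ℕ.* x ℕ.+ b ℕ.* w) * (inv (p !) * inv (q !) * nat (x ℕ.^ p ℕ.* (x ℕ.+ w) ℕ.^ q))
        ≈⟨ *-congˡ (binomial-identity {p} {q} p+q≡s x w) ⟩
      pow η (g ℕ.* x ℕ.+ b ℕ.* w) * ∑ 0 (suc s) (λ j → nat (j C p) * (inv (j !) * inv ((s ∸ j) !)) * nat (x ℕ.^ j ℕ.* w ℕ.^ (s ∸ j)))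
        ≈⟨ trans (*-distribˡ-∑ 0 (suc s) _ _) (∑-cong 0 (suc s) (λ j → x∙yz≈y∙xz _ _ _)) ⟩
      ∑ 0 (suc s) (λ j → nat (j C p) * (inv (j !) * inv ((s ∸ j) !))
                         * (pow η (g ℕ.* x ℕ.+ b ℕ.* w) * nat (x ℕ.^ j ℕ.* w ℕ.^ (s ∸ j))))
        ∎

    upper-pairSum≈depth-two : ∀ {p q s} → p ℕ.+ q ≡ s → ∀ n →
      inv (p !) * inv (q !) * pairSum (λ x y → 𝟙 (x <ᵇ y) * (weight a p x * weight b q y)) n
      ≈ Σ1 (suc s) (λ i → nat ((i ∸ 1) C p) * div2 i (s ℕ.+ 2 ∸ i) γ β n)
    upper-pairSum≈depth-two {p} {q} {s} p+q≡s n = begin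
      inv (p !) * inv (q !) * pairSum (λ x y → 𝟙 (x <ᵇ y) * (weight a p x * weight b q y)) n
        ≈⟨ trans (*-congˡ (pairSum-upper n _)) (*-orderedPairSum n _ _) ⟩
      orderedPairSum (λ x w → inv (p !) * inv (q !) * (weight a p x * weight b q (x ℕ.+ w))) n
        ≈⟨ orderedPairSum-cong n (weight-binomial {p} {q} p+q≡s) ⟩
      orderedPairSum (λ x w → ∑ 0 (suc s) (λ j → nat (j C p) * (inv (j !) * inv ((s ∸ j) !)) * monomial j x w)) n
        ≈⟨ ∑-orderedPairSum 0 (suc s) n _ ⟨
      ∑ 0 (suc s) (λ j → orderedPairSum (λ x w → nat (j C p) * (inv (j !) * inv ((s ∸ j) !)) * monomial j x w) n)
        ≈⟨ ∑-cong 0 (suc s) (λ j → trans (sym (*-orderedPairSum n _ _))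
                                   (trans (*-assoc _ _ _) (*-congˡ (orderedPairSum≈div2 γ β s j n)))) ⟩
      ∑ 0 (suc s) (λ j → nat (j C p) * div2 (suc j) (s ℕ.+ 2 ∸ suc j) γ β n)
        ≡⟨ ≡.trans (Σ1≡∑ (suc s) _) (∑-suc 0 (suc s) _) ⟨
      Σ1 (suc s) (λ i → nat ((i ∸ 1) C p) * div2 i (s ℕ.+ 2 ∸ i) γ β n)
        ∎
      where
      monomial : ℕ → ℕ → ℕ → Carrier
      monomial j x w = pow η (g ℕ.* x ℕ.+ b ℕ.* w) * nat (x ℕ.^ j ℕ.* w ℕ.^ (s ∸ j))

    diagonal-summand : ∀ {p q s} → p ℕ.+ q ≡ suc s → ∀ U v →
      inv (p !) * inv (q !) * (U × (weight a p v * weight b q v)) + nat (suc s C p) * inv (suc s !) * weight g (suc s) v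
      ≈ ι (natℚ (suc s C p) ℚ.* invℚ (suc s)) * (inv (s !) * (nat (suc U ℕ.* v) * weight g s v))
    diagonal-summand {p} {q} {s} p+q≡1+s U v = begin
      inv (p !) * inv (q !) * (U × (weight a p v * weight b q v)) + c * inv (suc s !) * weight g (suc s) v
        ≈⟨ +-congʳ (*-cong (p!⁻¹*q!⁻¹≈sCp*s!⁻¹ {p} {q} p+q≡1+s) (trans (×≈nat* U _) (*-congˡ (weight-* {p} {q} p+q≡1+s v)))) ⟩
      c * inv (suc s !) * (nat U * weight g (suc s) v) + c * inv (suc s !) * weight g (suc s) v
        ≈⟨ solve 3 (λ X A W → X :* (A :* W) :+ X :* W := X :* ((con 1 :+ A) :* W)) refl _ _ _ ⟩
      c * inv (suc s !) * ((1# + nat U) * weight g (suc s) v)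
        ≈⟨ *-cong (*-congˡ (inv-* {suc s} {s !} (s≤s z≤n) (ℕ.1≤n! s)))
                  (*-cong (sym (trans (nat-+ 1 U) (+-congʳ 1#-homo))) (*-congˡ (nat-* v (v ℕ.^ s)))) ⟩
      c * (inv (suc s) * inv (s !)) * (nat (suc U) * (pow η (g ℕ.* v) * (nat v * nat (v ℕ.^ s))))
        ≈⟨ solve 7 (λ C I J K E V W → C :* (I :* J) :* (K :* (E :* (V :* W))) := C :* I :* (J :* ((K :* V) :* (E :* W))))
                   refl _ _ _ _ _ _ _ ⟩
      c * inv (suc s) * (inv (s !) * ((nat (suc U) * nat v) * weight g s v))
        ≈⟨ *-cong (sym (*-homo _ _)) (*-congˡ (*-congʳ (sym (nat-* (suc U) v)))) ⟩
      ι (natℚ (suc s C p) ℚ.* invℚ (suc s)) * (inv (s !) * (nat (suc U ℕ.* v) * weight g s v))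
        ∎
      where c = nat (suc s C p)

    diagonal-pairSum≈derivative : ∀ {p q s} → p ℕ.+ q ≡ s → 1 ≤ s → ∀ n →
      inv (p !) * inv (q !) * pairSum (λ x y → 𝟙 (x ≡ᵇ y) * (weight a p x * weight b q y)) n
        + nat (s C p) * div1 (suc s) γ n
      ≈ ι (natℚ (s C p) ℚ.* invℚ s) * 𝔇 (div1 s γ) n
    diagonal-pairSum≈derivative {p} {q} {s@(suc s′)} p+q≡s _ n = begin
      cpq * pairSum (λ x y → 𝟙 (x ≡ᵇ y) * (weight a p x * weight b q y)) n + c * div1 (suc s) γ n
        ≈⟨ +-cong (*-congˡ (pairSum-diagonal n _)) (*-congˡ (div1≈divisorSum (suc s) γ n)) ⟩
      cpq * divisorSum (λ U v → (U ∸ 1) × (weight a p v * weight b q v)) n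
        + c * (inv (s !) * divisorSum (λ _ → weight g s) n)
        ≈⟨ +-cong (*-divisorSum (λ _ → cpq) _ n) (trans (sym (*-assoc _ _ _)) (*-divisorSum (λ _ → c * inv (s !)) _ n)) ⟩
      divisorSum (λ U v → cpq * ((U ∸ 1) × (weight a p v * weight b q v))) n
        + divisorSum (λ _ v → c * inv (s !) * weight g s v) n
        ≈⟨ divisorSum-distrib-+ n _ _ ⟨
      divisorSum (λ U v → cpq * ((U ∸ 1) × (weight a p v * weight b q v)) + c * inv (s !) * weight g s v) n
        ≈⟨ divisorSum-cong n (λ { (suc U) v _ → diagonal-summand {p} {q} p+q≡s U v }) ⟩
      divisorSum (λ U v → c/s * (inv (s′ !) * (nat (U ℕ.* v) * weight g s′ v))) n
        ≈⟨ trans (*-congˡ (*-divisorSum (λ _ → inv (s′ !)) _ n)) (*-divisorSum (λ _ → c/s) _ n) ⟨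
      c/s * (inv (s′ !) * divisorSum (λ U v → nat (U ℕ.* v) * weight g s′ v) n)
        ≈⟨ *-congˡ (*-congˡ (*-divisorSum nat (λ _ → weight g s′) n)) ⟨
      c/s * (inv (s′ !) * (nat n * divisorSum (λ _ → weight g s′) n))
        ≈⟨ *-congˡ (trans (*-congˡ (div1≈divisorSum s γ n)) (x∙yz≈y∙xz _ _ _)) ⟨
      c/s * 𝔇 (div1 s γ) n
        ∎
      where
      cpq = inv (p !) * inv (q !)
      c   = nat (s C p)
      c/s = ι (natℚ (s C p) ℚ.* invℚ s)

  product-decomposition : ∀ {N} (α β γ : Fin N) →
    (∀ v → pow η (toℕ γ ℕ.* v) ≈ pow η (toℕ α ℕ.* v) * pow η (toℕ β ℕ.* v)) →
    ∀ {p q s} → p ℕ.+ q ≡ s → 1 ≤ s → ∀ n →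
    ι (natℚ (s C p) ℚ.* invℚ s) * 𝔇 (div1 s γ) n
    ≈ (div1 (suc p) α ⋆ div1 (suc q) β) n + ι (natℚ (s C p)) * div1 (suc s) γ n
      - Σ1 (suc s) (λ i → ι (natℚ ((i ∸ 1) C p)) * div2 i (s ℕ.+ 2 ∸ i) γ β n
                         + ι (natℚ ((i ∸ 1) C q)) * div2 i (s ℕ.+ 2 ∸ i) γ α n)
  product-decomposition α β γ ηᵞ≈ηᵅηᵝ {p} {q} {s} p+q≡s 1≤s n = begin
    ι (natℚ (s C p) ℚ.* invℚ s) * 𝔇 (div1 s γ) n
      ≈⟨ Decomposition.diagonal-pairSum≈derivative α β γ ηᵞ≈ηᵅηᵝ {p} {q} p+q≡s 1≤s n ⟨
    diagonal + nat (s C p) * div1 (suc s) γ n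
      ≈⟨ //-rightDividesʳ (Σβ + Σα) _ ⟨
    diagonal + nat (s C p) * div1 (suc s) γ n + (Σβ + Σα) - (Σβ + Σα)
      ≈⟨ +-congʳ (solve 4 (λ D E B A → D :+ E :+ (B :+ A) := B :+ (D :+ A) :+ E) refl _ _ _ _) ⟩
    Σβ + (diagonal + Σα) + nat (s C p) * div1 (suc s) γ n - (Σβ + Σα)
      ≈⟨ +-cong (+-congʳ product≈) (-‿cong Σ-split) ⟨
    (div1 (suc p) α ⋆ div1 (suc q) β) n + nat (s C p) * div1 (suc s) γ n - Σ1 (suc s) (λ i → fβ i + fα i)
      ∎
    where
    cpq = inv (p !) * inv (q !)
    G : ℕ → ℕ → Carrier
    G x y = weight (toℕ α) p x * weight (toℕ β) q y
    diagonal = cpq * pairSum (λ x y → 𝟙 (x ≡ᵇ y) * G x y) n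
    fβ fα : ℕ → Carrier
    fβ i = nat ((i ∸ 1) C p) * div2 i (s ℕ.+ 2 ∸ i) γ β n
    fα i = nat ((i ∸ 1) C q) * div2 i (s ℕ.+ 2 ∸ i) γ α n
    Σβ = Σ1 (suc s) fβ
    Σα = Σ1 (suc s) fα

    Σ-split : Σ1 (suc s) (λ i → fβ i + fα i) ≈ Σβ + Σα
    Σ-split = begin
      Σ1 (suc s) (λ i → fβ i + fα i)   ≡⟨ Σ1≡∑ (suc s) _ ⟩
      ∑ 1 (suc s) (λ i → fβ i + fα i)  ≈⟨ ∑-distrib-+ 1 (suc s) fβ fα ⟩
      ∑ 1 (suc s) fβ + ∑ 1 (suc s) fα  ≡⟨ ≡.cong₂ _+_ (Σ1≡∑ (suc s) fβ) (Σ1≡∑ (suc s) fα) ⟨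
      Σβ + Σα                          ∎

    lower : cpq * pairSum (λ x y → 𝟙 (y <ᵇ x) * G x y) n ≈ Σα
    lower = begin
      cpq * pairSum (λ x y → 𝟙 (y <ᵇ x) * G x y) n
        ≈⟨ *-cong (*-comm _ _) (trans (pairSum-swap n _) (pairSum-cong n (λ x y → *-congˡ (*-comm _ _)))) ⟩
      inv (q !) * inv (p !) * pairSum (λ x y → 𝟙 (x <ᵇ y) * (weight (toℕ β) q x * weight (toℕ α) p y)) n
        ≈⟨ Decomposition.upper-pairSum≈depth-two β α γ (λ v → trans (ηᵞ≈ηᵅηᵝ v) (*-comm _ _))
                                             {q} {p} (≡.trans (ℕ.+-comm q p) p+q≡s) n ⟩
      Σα
        ∎

    product≈ : (div1 (suc p) α ⋆ div1 (suc q) β) n ≈ Σβ + (diagonal + Σα)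
    product≈ = begin
      (div1 (suc p) α ⋆ div1 (suc q) β) n
        ≈⟨ div1⋆div1 (suc p) (suc q) α β n ⟩
      cpq * pairSum G n
        ≈⟨ *-congˡ (pairSum-trichotomy n G) ⟩
      cpq * (pairSum (λ x y → 𝟙 (x <ᵇ y) * G x y) n
             + (pairSum (λ x y → 𝟙 (x ≡ᵇ y) * G x y) n + pairSum (λ x y → 𝟙 (y <ᵇ x) * G x y) n))
        ≈⟨ trans (distribˡ _ _ _) (+-congˡ (distribˡ _ _ _)) ⟩
      cpq * pairSum (λ x y → 𝟙 (x <ᵇ y) * G x y) n
        + (diagonal + cpq * pairSum (λ x y → 𝟙 (y <ᵇ x) * G x y) n)
        ≈⟨ +-cong (Decomposition.upper-pairSum≈depth-two α β γ ηᵞ≈ηᵅηᵝ {p} {q} p+q≡s n) (+-congˡ lower) ⟩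
      Σβ + (diagonal + Σα)
        ∎

proposition7p3 :
  {c ℓ : Level} (R : CommutativeRing c ℓ)
  (ι : ℚ → CommutativeRing.Carrier R)
  → IsRingHomomorphism +-*-rawRing (CommutativeRing.rawRing R) ι
  → (N : ℕ) .{{_ : NonZero N}}
  → (η : CommutativeRing.Carrier R)
  → CommutativeRing._≈_ R (Series.pow R ι η η N) (CommutativeRing.1# R)
  → (∀ k → 0 < k → k < N → ¬ CommutativeRing._≈_ R (Series.pow R ι η η k) (CommutativeRing.1# R))
  → (α β : Fin N) (s₁ s₂ : ℕ) → 1 ≤ s₁ → 1 ≤ s₂ → 2 < s₁ ℕ.+ s₂
  → let open CommutativeRing R
        open Series R ι η
        s = s₁ ℕ.+ s₂ ∸ 2
        αβ = addMod N α β
    in ∀ n →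
       ι (Data.Rational._*_ (natℚ (s C (s₁ ∸ 1))) (invℚ s)) * 𝔇 (div1 s αβ) n
       ≈ (div1 s₁ α ⋆ div1 s₂ β) n
         + ι (natℚ (s C (s₁ ∸ 1))) * div1 (ℕ.suc s) αβ n
         - Σ1 (ℕ.suc s) (λ a →
             ι (natℚ ((a ∸ 1) C (s₁ ∸ 1))) * div2 a (s ℕ.+ 2 ∸ a) αβ β n
             + ι (natℚ ((a ∸ 1) C (s₂ ∸ 1))) * div2 a (s ℕ.+ 2 ∸ a) αβ α n)
proposition7p3 R ι ι-hom N η ηᴺ≈1 _ α β (suc p) (suc q) (s≤s z≤n) (s≤s z≤n) 2<s₁+s₂ =
  product-decomposition α β (addMod N α β) (pow-addMod N ηᴺ≈1 α β) {p} {q} p+q≡s (ℕ.∸-monoˡ-≤ 2 2<s₁+s₂)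
  where
  open MultipleDivisorFunctions R ι ι-hom η
  p+q≡s : p ℕ.+ q ≡ suc p ℕ.+ suc q ∸ 2
  p+q≡s = ≡.cong (_∸ 1) (≡.sym (ℕ.+-suc p q))
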